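{- For every integer $k\ge 1$ there is a connected chordal graph $G$ with $\mathrm{mp}(G)=9k$, $\mathrm{mp}_f(G)/\mathrm{mp}(G)=10/9$ and $\gamma_b(G)/\mathrm{mp}(G)=10/9$.
   Context: All graphs are finite, simple and undirected; $d(u,v)$ is the shortest-path distance and $\mathrm{diam}(G)$ the diameter. A graph is chordal if every cycle on four or more vertices has a chord. For $v\in V(G)$ and integer $r\ge 0$, $N_r[v]=\{u: d(u,v)\le r\}$. A broadcast on $G$ is a function $f:V(G)\to\{0,1,\dots,\mathrm{diam}(G)\}$; it is dominating if for every $u\in V(G)$ there is $v$ (possibly $v=u$) with $f(v)>0$ and $d(u,v)\le f(v)$. Its cost is $\sum_v f(v)$, and $\gamma_b(G)$ is the minimum cost of a dominating broadcast. A multipacking is a set $M\subseteq V(G)$ with $|N_r[v]\cap M|\le r$ for every $v$ and every integer $r\ge 1$; $\mathrm{mp}(G)$ is the maximum size of a multipacking. A fractional multipacking is a function $w:V(G)\to[0,\infty)$ with $\sum_{u\in N_r[v]}w(u)\le r$ for every $v$ and every integer $r\ge1$; $\mathrm{mp}_f(G)$ is the maximum of $\sum_{u}w(u)$ over fractional multipackings $w$.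
   Formalization: The fractional multipacking weights take values in the nonnegative rationals rather than in $[0,\infty)$, both for the optimal weighting and for those it is compared against. -}

module Defs where

open import Data.Nat as ℕ using (ℕ; zero; suc; _≤_; _<_; NonZero)
open import Data.Nat.DivMod using (_%_; m%n<n)
open import Data.Fin as Fin using (Fin; toℕ; fromℕ<; _≟_)
open import Data.Bool using (Bool; true; false; _∧_; _∨_; if_then_else_)
open import Data.List using (List; length; filterᵇ; allFin; foldr; map)
open import Data.Bool.ListAction using (any)
open import Data.Product using (Σ; ∃; _×_; _,_)
open import Data.Integer using (+_)
open import Data.Rational as ℚ using (ℚ; 0ℚ)
open import Relation.Nullary using (¬_; does)
open import Relation.Binary.PropositionalEquality using (_≡_; _≢_)

record Graph : Set where
  field
    n     : ℕ
    adj   : Fin n → Fin n → Bool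
    sym   : ∀ u v → adj u v ≡ adj v u
    irrefl : ∀ v → adj v v ≡ false
open Graph public

Vertex : Graph → Set
Vertex G = Fin (n G)

within : (G : Graph) → ℕ → Vertex G → Vertex G → Bool
within G zero    u v = does (u ≟ v)
within G (suc r) u v = within G r u v ∨ any (λ w → adj G u w ∧ within G r w v) (allFin (n G))

Dist≤ : (G : Graph) → ℕ → Vertex G → Vertex G → Set
Dist≤ G r u v = within G r u v ≡ true

Connected : Graph → Set
Connected G = ∀ u v → ∃ λ r → Dist≤ G r u v

nextFin : ∀ {m} → Fin (suc m) → Fin (suc m)
nextFin {m} i = fromℕ< (m%n<n (suc (toℕ i)) (suc m))

-- A cycle of length suc m: injective c with c i adjacent to c (i+1 mod (suc m)).
IsCycle : (G : Graph) (m : ℕ) → (Fin (suc m) → Vertex G) → Set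
IsCycle G m c = (∀ i j → c i ≡ c j → i ≡ j) × (∀ i → adj G (c i) (c (nextFin i)) ≡ true)

HasChord : (G : Graph) (m : ℕ) → (Fin (suc m) → Vertex G) → Set
HasChord G m c = ∃ λ i → ∃ λ j →
  (i ≢ j) × (j ≢ nextFin i) × (i ≢ nextFin j) × (adj G (c i) (c j) ≡ true)

Chordal : Graph → Set
Chordal G = ∀ m → 3 ≤ m → (c : Fin (suc m) → Vertex G) → IsCycle G m c → HasChord G m c

-- f(v) ≤ diam(G): either f v = 0 or some pair of vertices is at distance ≥ f v.
≤Diam : (G : Graph) → ℕ → Set
≤Diam G zero    = Vertex G   -- 0 ≤ diam(G) (nonempty vertex set)
≤Diam G (suc m) = ∃ λ u → ∃ λ w → ¬ Dist≤ G m u w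

sumℕ : ∀ {A : Set} → (A → ℕ) → List A → ℕ
sumℕ f = foldr (λ a s → f a ℕ.+ s) 0

sumℚ : ∀ {A : Set} → (A → ℚ) → List A → ℚ
sumℚ f = foldr (λ a s → f a ℚ.+ s) 0ℚ

IsBroadcast : (G : Graph) → (Vertex G → ℕ) → Set
IsBroadcast G f = ∀ v → ≤Diam G (f v)

Dominating : (G : Graph) → (Vertex G → ℕ) → Set
Dominating G f = ∀ u → ∃ λ v → (0 < f v) × Dist≤ G (f v) u v

cost : (G : Graph) → (Vertex G → ℕ) → ℕ
cost G f = sumℕ f (allFin (n G))

BroadcastDomNumber : Graph → ℕ → Set
BroadcastDomNumber G c =
  (∃ λ f → IsBroadcast G f × Dominating G f × cost G f ≡ c) ×
  (∀ f → IsBroadcast G f → Dominating G f → c ≤ cost G f)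

card : (G : Graph) → (Vertex G → Bool) → ℕ
card G M = length (filterᵇ M (allFin (n G)))

IsMultipacking : (G : Graph) → (Vertex G → Bool) → Set
IsMultipacking G M = ∀ v r → 1 ≤ r →
  card G (λ u → M u ∧ within G r v u) ≤ r

MultipackingNumber : Graph → ℕ → Set
MultipackingNumber G c =
  (∃ λ M → IsMultipacking G M × card G M ≡ c) ×
  (∀ M → IsMultipacking G M → card G M ≤ c)

ℕtoℚ : ℕ → ℚ
ℕtoℚ r = + r ℚ./ 1

IsFracMultipacking : (G : Graph) → (Vertex G → ℚ) → Set
IsFracMultipacking G w = (∀ v → 0ℚ ℚ.≤ w v) ×
  (∀ v r → 1 ≤ r →
     sumℚ (λ u → if within G r v u then w u else 0ℚ) (allFin (n G)) ℚ.≤ ℕtoℚ r)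

weight : (G : Graph) → (Vertex G → ℚ) → ℚ
weight G w = sumℚ w (allFin (n G))

FracMultipackingNumber : Graph → ℚ → Set
FracMultipackingNumber G q =
  (∃ λ w → IsFracMultipacking G w × weight G w ≡ q) ×
  (∀ w → IsFracMultipacking G w → weight G w ℚ.≤ q)

-- The graph is a chain of k copies of a 36-vertex chordal unit U, the exit 34 of each copy joined by
-- a bridge edge to the entry 0 of the next. Gluing along a bridge concatenates perfect elimination
-- orders, so the chain is chordal, and distances simply add up across bridges.
-- A multipacking restricts to one on every copy, and one on U has at most 9 vertices: U splits into
-- three parts, each covered twice by 2b + 1 closed neighbourhoods (b = 3, 4, 2), each of which a
-- multipacking meets at most once. Weak duality gives mp_f ≤ γ_b, and a broadcast of cost 10 per
-- copy dominates. Conversely, 9 vertices per copy form a multipacking, and weight 1/2 on 20 vertices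
-- per copy a fractional one: an invariant along the chain bounds the weight near its last exit by a
-- profile of period d(0, 34) + 1 = 24, leaving room for the copies still to come, and so reduces the
-- ball condition to a local one on U, checked by evaluation for radii below 48 and periodic beyond.

module Submission where

open import Defs hiding (sym)

open import Data.Bool using (Bool; true; false; T; _∧_; if_then_else_)
import Data.Bool.Properties as BoolP
open import Data.Empty using (⊥-elim)
open import Data.Fin as Fin using (Fin; zero; suc; toℕ; #_; _↑ˡ_; _↑ʳ_; splitAt; join)
import Data.Fin.Properties as FinP
open FinP using (all?; any?)
import Data.Integer as ℤ
import Data.Integer.Properties as ℤP
open import Data.List using (List; []; _∷_; allFin; tabulate; length; filterᵇ)
open import Data.List.Extrema.Nat using (argmin; f[argmin]≤f[xs])
open import Data.List.Membership.DecPropositional (Fin._≟_ {36}) using (_∈_; _∈?_; find)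
open import Data.List.Membership.Propositional.Properties using (∈-allFin)
open import Data.List.Relation.Unary.All as All using (All)
open import Data.List.Relation.Unary.Any as Any using (Any)
open import Data.List.Relation.Unary.Any.Properties using (any⁺; any⁻)
open import Data.Nat as ℕ using (ℕ; zero; suc; _+_; _*_; _∸_; _≤_; _<_; _≤ᵇ_; _<ᵇ_; z≤n; s≤s)
import Data.Nat.Coprimality as Coprime
open import Data.Nat.DivMod
  using (_%_; m<n⇒m%n≡m; m<n⇒m/n≡0; m/n≡1+[m∸n]/n; %-distribˡ-+; m%n%n≡m%n; m≡m%n+[m/n]*n; [m+n]%n≡m%n)
  renaming (_/_ to _÷_)
open import Data.Nat.Induction using (<-rec)
import Data.Nat.Properties as ℕP
open import Data.Nat.Solver using (module +-*-Solver)
open import Data.Product using (∃; _×_; _,_; proj₁; proj₂)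
open import Data.Rational as ℚ using (ℚ; mkℚ; 0ℚ; 1ℚ; ½)
import Data.Rational.Properties as ℚP
open import Data.Sum using (_⊎_; inj₁; inj₂)
open import Data.Sum.Properties using ([,]-∘)
open import Data.Vec using (Vec; []; _∷_; lookup)
open import Data.Vec.Functional using (_++_)
open import Data.Vec.Functional.Properties using (lookup-++ˡ; lookup-++ʳ; ++-cong)
open import Function using (_∘_; id; Equivalence; _⇔_; mk⇔)
open import Relation.Binary.PropositionalEquality
open import Relation.Nullary using (¬_; Dec; does; yes; no)
open import Relation.Nullary.Decidable using (dec-true; from-yes; T?; _×-dec_; _⊎-dec_; _→-dec_; ¬?)

open import Algebra.Properties.CommutativeMonoid.Sum ℕP.+-0-commutativeMonoid
  using (sum; sum-cong-≗; sum-replicate-zero; ∑-distrib-+; ∑-comm)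
import Algebra.Properties.CommutativeMonoid.Sum ℚP.+-0-commutativeMonoid as ∑ℚ

open Equivalence using (to; from)

T-does⁺ : ∀ {a} {A : Set a} (a? : Dec A) → A → T (does a?)
T-does⁺ a? a = from BoolP.T-≡ (dec-true a? a)

T-does⁻ : ∀ {a} {A : Set a} (a? : Dec A) → T (does a?) → A
T-does⁻ (yes a) _ = a

if-T : ∀ {A : Set} {b} {x y : A} → T b → (if b then x else y) ≡ x
if-T {b = true} _ = refl

if-F : ∀ {A : Set} {b} {x y : A} → ¬ T b → (if b then x else y) ≡ y
if-F {b = false} _ = refl
if-F {b = true}  ¬T = ⊥-elim (¬T _)

T-extensional : ∀ {a b} → (T a → T b) → (T b → T a) → a ≡ b
T-extensional {false} {false} _ _ = refl
T-extensional {false} {true}  _ g = ⊥-elim (g _)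
T-extensional {true}  {false} f _ = ⊥-elim (f _)
T-extensional {true}  {true}  _ _ = refl

below-from-Fin : ∀ {N} {P : ℕ → Set} → (∀ (r : Fin N) → P (toℕ r)) → ∀ r → r < N → P r
below-from-Fin {P = P} check r r<N = subst P (FinP.toℕ-fromℕ< r<N) (check (Fin.fromℕ< r<N))

-- Walks and distances

-- Dist≤ wrapped in a record, so that the graph, the radius and the end points can be inferred.
record Reach (G : Graph) (r : ℕ) (u v : Vertex G) : Set where
  constructor reach
  field reached : T (within G r u v)

  dist≤ : Dist≤ G r u v
  dist≤ = to BoolP.T-≡ reached

toReach : ∀ G r u v → Dist≤ G r u v → Reach G r u v
toReach G r u v h = reach (from BoolP.T-≡ h)

Edge : (G : Graph) → Vertex G → Vertex G → Set
Edge G u v = adj G u v ≡ true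

module _ {G : Graph} where

  reach-refl : ∀ u → Reach G 0 u u
  reach-refl u = reach (T-does⁺ (u Fin.≟ u) refl)

  reach-0 : ∀ {u v} → Reach G 0 u v → u ≡ v
  reach-0 {u} {v} (reach h) = T-does⁻ (u Fin.≟ v) h

  reach-weaken : ∀ {r u v} → Reach G r u v → Reach G (suc r) u v
  reach-weaken (reach h) = reach (from BoolP.T-∨ (inj₁ h))

  reach-step : ∀ {r u w v} → Edge G u w → Reach G r w v → Reach G (suc r) u v
  reach-step {w = w} e (reach h) =
    reach (from BoolP.T-∨ (inj₂ (any⁺ _ (Any.map (λ { refl → from BoolP.T-∧ (from BoolP.T-≡ e , h) })
                                                 (∈-allFin w)))))

  reach-split : ∀ {r u v} → Reach G (suc r) u v → Reach G r u v ⊎ ∃ λ w → Edge G u w × Reach G r w v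
  reach-split (reach h) with to BoolP.T-∨ h
  ... | inj₁ h′ = inj₁ (reach h′)
  ... | inj₂ h′ with Any.satisfied (any⁻ _ (allFin _) h′)
  ...   | w , e∧h = let e , h″ = to BoolP.T-∧ e∧h in inj₂ (w , to BoolP.T-≡ e , reach h″)

  reach-mono : ∀ {r s u v} → r ≤ s → Reach G r u v → Reach G s u v
  reach-mono {zero} {zero} _ h = h
  reach-mono {zero} {suc s} _ h = reach-weaken (reach-mono z≤n h)
  reach-mono {suc r} {suc s} (s≤s r≤s) h with reach-split h
  ... | inj₁ h′ = reach-weaken (reach-mono r≤s h′)
  ... | inj₂ (w , e , h′) = reach-step e (reach-mono r≤s h′)

  reach-trans : ∀ {r s u v x} → Reach G r u v → Reach G s v x → Reach G (r + s) u x
  reach-trans {zero} h₁ h₂ with refl ← reach-0 h₁ = h₂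
  reach-trans {suc r} h₁ h₂ with reach-split h₁
  ... | inj₁ h′ = reach-weaken (reach-trans h′ h₂)
  ... | inj₂ (w , e , h′) = reach-step e (reach-trans h′ h₂)

  reach-sym : ∀ {r u v} → Reach G r u v → Reach G r v u
  reach-sym {zero} h with refl ← reach-0 h = h
  reach-sym {suc r} {u} {v} h with reach-split h
  ... | inj₁ h′ = reach-weaken (reach-sym h′)
  ... | inj₂ (w , e , h′) = subst (λ k → Reach G k v u) (ℕP.+-comm r 1)
                              (reach-trans (reach-sym h′) (reach-step (trans (Graph.sym G w u) e) (reach-refl u)))

  reach-lipschitz : (φ : Vertex G → ℕ) → (∀ {x y} → Edge G x y → φ y ≤ suc (φ x)) →
                    ∀ {r u v} → Reach G r u v → φ v ≤ r + φ u
  reach-lipschitz φ lip {zero} h with refl ← reach-0 h = ℕP.≤-refl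
  reach-lipschitz φ lip {suc r} {u} h with reach-split h
  ... | inj₁ h′ = ℕP.m≤n⇒m≤1+n (reach-lipschitz φ lip h′)
  ... | inj₂ (w , e , h′) = begin
    φ _            ≤⟨ reach-lipschitz φ lip h′ ⟩
    r + φ w        ≤⟨ ℕP.+-monoʳ-≤ r (lip e) ⟩
    r + suc (φ u)  ≡⟨ ℕP.+-suc r (φ u) ⟩
    suc r + φ u    ∎
    where open ℕP.≤-Reasoning

reach-map : ∀ {G H : Graph} (h : Vertex G → Vertex H) →
            (∀ {x y} → Edge G x y → Edge H (h x) (h y)) →
            ∀ {r u v} → Reach G r u v → Reach H r (h u) (h v)
reach-map h hom {zero} r₀ with refl ← reach-0 r₀ = reach-refl _
reach-map h hom {suc r} r₁ with reach-split r₁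
... | inj₁ r′ = reach-weaken (reach-map h hom r′)
... | inj₂ (w , e , r′) = reach-step (hom e) (reach-map h hom r′)

record Distance (G : Graph) : Set where
  field
    d         : Vertex G → Vertex G → ℕ
    reach-d   : ∀ u v → Reach G (d u v) u v
    d-minimal : ∀ {r u v} → Reach G r u v → d u v ≤ r

  d-self : ∀ u → d u u ≡ 0
  d-self u = ℕP.n≤0⇒n≡0 (d-minimal (reach-refl u))

  d-sym : ∀ u v → d u v ≡ d v u
  d-sym u v = ℕP.≤-antisym (d-minimal (reach-sym (reach-d v u))) (d-minimal (reach-sym (reach-d u v)))

  d-edge : ∀ x {y z} → Edge G y z → d x z ≤ suc (d x y)
  d-edge x {y} {z} e = subst (d x z ≤_) (ℕP.+-comm (d x y) 1)
                         (d-minimal (reach-trans (reach-d x y) (reach-step e (reach-refl z))))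

  reach⇔d≤ : ∀ {r u v} → Reach G r u v ⇔ d u v ≤ r
  reach⇔d≤ = mk⇔ d-minimal (λ d≤r → reach-mono d≤r (reach-d _ _))

  within≡d≤ᵇ : ∀ r u v → within G r u v ≡ (d u v ≤ᵇ r)
  within≡d≤ᵇ r u v = T-extensional (ℕP.≤⇒≤ᵇ ∘ d-minimal ∘ reach)
                                    (Reach.reached ∘ from reach⇔d≤ ∘ ℕP.≤ᵇ⇒≤ _ _)

  connected : Connected G
  connected u v = d u v , Reach.dist≤ (reach-d u v)

≤Diam-from-distance : ∀ {G} (D : Distance G) {x} p q → x ≤ Distance.d D p q → ≤Diam G x
≤Diam-from-distance {G} D {zero}  p q _   = p
≤Diam-from-distance {G} D {suc x} p q x<d = p , q , λ h → ℕP.<⇒≱ x<d (Distance.d-minimal D (toReach G x p q h))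

-- Perfect elimination orders

record PerfectEliminationOrder (G : Graph) : Set where
  field
    rank           : Vertex G → ℕ
    rank-injective : ∀ {u v} → rank u ≡ rank v → u ≡ v
    simplicial     : ∀ {v u w} → Edge G v u → Edge G v w →
                     rank v < rank u → rank v < rank w → u ≢ w → Edge G u w

module _ {m : ℕ} where

  stepFin : ℕ → Fin (suc m) → Fin (suc m)
  stepFin zero    i = i
  stepFin (suc k) i = nextFin (stepFin k i)

  toℕ-stepFin : ∀ k i → toℕ (stepFin k i) ≡ (toℕ i + k) % suc m
  toℕ-stepFin zero i = begin
    toℕ i                 ≡⟨ sym (m<n⇒m%n≡m (FinP.toℕ<n i)) ⟩
    toℕ i % suc m         ≡⟨ cong (_% suc m) (sym (ℕP.+-identityʳ (toℕ i))) ⟩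
    (toℕ i + 0) % suc m   ∎
    where open ≡-Reasoning
  toℕ-stepFin (suc k) i = begin
    toℕ (nextFin (stepFin k i))     ≡⟨ FinP.toℕ-fromℕ< _ ⟩
    suc (toℕ (stepFin k i)) % N     ≡⟨ cong (λ x → suc x % N) (toℕ-stepFin k i) ⟩
    (1 + (t + k) % N) % N           ≡⟨ %-distribˡ-+ 1 ((t + k) % N) N ⟩
    (1 % N + (t + k) % N % N) % N   ≡⟨ cong (λ x → (1 % N + x) % N) (m%n%n≡m%n (t + k) N) ⟩
    (1 % N + (t + k) % N) % N       ≡⟨ sym (%-distribˡ-+ 1 (t + k) N) ⟩
    suc (t + k) % N                 ≡⟨ cong (_% N) (sym (ℕP.+-suc t k)) ⟩
    (t + suc k) % N                 ∎
    where
    open ≡-Reasoning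
    N t : ℕ
    N = suc m
    t = toℕ i

  stepFin-≢ : ∀ {k} i → 0 < k → k ≤ m → stepFin k i ≢ i
  stepFin-≢ {k} i 0<k k≤m eq = k≢q*N q k≡q*N
    where
    open ≡-Reasoning
    N t q : ℕ
    N = suc m
    t = toℕ i
    q = (t + k) ÷ N
    k≡q*N : k ≡ q * N
    k≡q*N = ℕP.+-cancelˡ-≡ t k (q * N) (begin
      t + k              ≡⟨ m≡m%n+[m/n]*n (t + k) N ⟩
      (t + k) % N + q * N ≡⟨ cong (_+ q * N) (trans (sym (toℕ-stepFin k i)) (cong toℕ eq)) ⟩
      t + q * N          ∎)
    k≢q*N : ∀ q → k ≢ q * N
    k≢q*N zero    k≡0 = ℕP.<⇒≢ 0<k (sym k≡0)
    k≢q*N (suc q) k≡N+qn = ℕP.<⇒≱ (s≤s k≤m) (subst (N ≤_) (sym k≡N+qn) (ℕP.m≤m+n N (q * N)))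

  stepFin-full : ∀ i → stepFin (suc m) i ≡ i
  stepFin-full i = FinP.toℕ-injective (begin
    toℕ (stepFin (suc m) i)   ≡⟨ toℕ-stepFin (suc m) i ⟩
    (toℕ i + suc m) % suc m   ≡⟨ [m+n]%n≡m%n (toℕ i) (suc m) ⟩
    toℕ i % suc m             ≡⟨ m<n⇒m%n≡m (FinP.toℕ<n i) ⟩
    toℕ i                     ∎)
    where open ≡-Reasoning

peo⇒chordal : ∀ {G} → PerfectEliminationOrder G → Chordal G
peo⇒chordal {G} peo m 3≤m c (c-injective , c-edge) =
  p , s , p≢s , s≢next[p] , p≢next[s] ,
  simplicial (edge-sym next[p]-edge) (c-edge i₀) (later p p≢i₀) (later s s≢i₀) (p≢s ∘ c-injective p s)
  where
  open PerfectEliminationOrder peo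
  i₀ s p : Fin (suc m)
  i₀ = argmin (rank ∘ c) zero (allFin (suc m))
  s  = stepFin 1 i₀
  p  = stepFin m i₀
  next[p]≡i₀ : nextFin p ≡ i₀
  next[p]≡i₀ = stepFin-full i₀
  s≢i₀ : s ≢ i₀
  s≢i₀ = stepFin-≢ i₀ (s≤s z≤n) (ℕP.≤-trans (s≤s z≤n) 3≤m)
  p≢s : p ≢ s
  p≢s p≡s = stepFin-≢ {k = 2} i₀ (s≤s z≤n) (ℕP.≤-trans (s≤s (s≤s z≤n)) 3≤m)
                      (trans (cong nextFin (sym p≡s)) next[p]≡i₀)
  s≢next[p] : s ≢ nextFin p
  s≢next[p] s≡next[p] = s≢i₀ (trans s≡next[p] next[p]≡i₀)
  p≢next[s] : p ≢ nextFin s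
  p≢next[s] p≡next[s] = stepFin-≢ {k = 3} i₀ (s≤s z≤n) 3≤m (trans (cong nextFin (sym p≡next[s])) next[p]≡i₀)
  p≢i₀ : p ≢ i₀
  p≢i₀ p≡i₀ = s≢i₀ (trans (cong nextFin (sym p≡i₀)) next[p]≡i₀)
  later : ∀ j → j ≢ i₀ → rank (c i₀) < rank (c j)
  later j j≢i₀ = ℕP.≤∧≢⇒< (All.lookup (f[argmin]≤f[xs] {f = rank ∘ c} zero (allFin (suc m))) (∈-allFin j))
                           (j≢i₀ ∘ sym ∘ c-injective i₀ j ∘ rank-injective)
  edge-sym : ∀ {x y} → Edge G x y → Edge G y x
  edge-sym {x} {y} e = trans (Graph.sym G y x) e
  next[p]-edge : Edge G (c p) (c i₀)
  next[p]-edge = subst (λ j → Edge G (c p) (c j)) next[p]≡i₀ (c-edge p)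

sumℕ-tabulate : ∀ {A : Set} {m} (f : A → ℕ) (g : Fin m → A) → sumℕ f (tabulate g) ≡ sum (f ∘ g)
sumℕ-tabulate {m = zero}  f g = refl
sumℕ-tabulate {m = suc m} f g = cong (f (g zero) +_) (sumℕ-tabulate f (g ∘ suc))

sumℚ-tabulate : ∀ {A : Set} {m} (f : A → ℚ) (g : Fin m → A) → sumℚ f (tabulate g) ≡ ∑ℚ.sum (f ∘ g)
sumℚ-tabulate {m = zero}  f g = refl
sumℚ-tabulate {m = suc m} f g = cong (f (g zero) ℚ.+_) (sumℚ-tabulate f (g ∘ suc))

𝟙 : Bool → ℕ
𝟙 b = if b then 1 else 0

length-filterᵇ-tabulate : ∀ {A : Set} {m} (P : A → Bool) (g : Fin m → A) →
                          length (filterᵇ P (tabulate g)) ≡ sum (𝟙 ∘ P ∘ g)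
length-filterᵇ-tabulate {m = zero}  P g = refl
length-filterᵇ-tabulate {m = suc m} P g with P (g zero)
... | true  = cong suc (length-filterᵇ-tabulate P (g ∘ suc))
... | false = length-filterᵇ-tabulate P (g ∘ suc)

card≡sum : ∀ G M → card G M ≡ sum (𝟙 ∘ M)
card≡sum G M = length-filterᵇ-tabulate M id

cost≡sum : ∀ G f → cost G f ≡ sum f
cost≡sum G f = sumℕ-tabulate f id

weight≡sum : ∀ G w → weight G w ≡ ∑ℚ.sum w
weight≡sum G w = sumℚ-tabulate w id

sum-mono-≤ : ∀ {m} {f g : Fin m → ℕ} → (∀ i → f i ≤ g i) → sum f ≤ sum g
sum-mono-≤ {zero}  f≤g = z≤n
sum-mono-≤ {suc m} f≤g = ℕP.+-mono-≤ (f≤g zero) (sum-mono-≤ (f≤g ∘ suc))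

sum-≤-* : ∀ {m} {f : Fin m → ℕ} c → (∀ i → f i ≤ c) → sum f ≤ m * c
sum-≤-* {zero}  c f≤c = z≤n
sum-≤-* {suc m} c f≤c = ℕP.+-mono-≤ (f≤c zero) (sum-≤-* c (f≤c ∘ suc))

sum-↑ : ∀ m {n} (f : Fin (m + n) → ℕ) → sum f ≡ sum (f ∘ (_↑ˡ n)) + sum (f ∘ (m ↑ʳ_))
sum-↑ zero    f = refl
sum-↑ (suc m) f = trans (cong (f zero +_) (sum-↑ m (f ∘ suc))) (sym (ℕP.+-assoc (f zero) _ _))

sum-++ : ∀ {m n} (xs : Fin m → ℕ) (ys : Fin n → ℕ) → sum (xs ++ ys) ≡ sum xs + sum ys
sum-++ {m} xs ys = trans (sum-↑ m (xs ++ ys))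
                         (cong₂ _+_ (sum-cong-≗ (lookup-++ˡ xs ys)) (sum-cong-≗ (lookup-++ʳ xs ys)))

sumℚ-mono-≤ : ∀ {m} {f g : Fin m → ℚ} → (∀ i → f i ℚ.≤ g i) → ∑ℚ.sum f ℚ.≤ ∑ℚ.sum g
sumℚ-mono-≤ {zero}  f≤g = ℚP.≤-refl
sumℚ-mono-≤ {suc m} f≤g = ℚP.+-mono-≤ (f≤g zero) (sumℚ-mono-≤ (f≤g ∘ suc))

sumℚ-nonneg : ∀ {m} {f : Fin m → ℚ} → (∀ i → 0ℚ ℚ.≤ f i) → 0ℚ ℚ.≤ ∑ℚ.sum f
sumℚ-nonneg {m} {f} f≥0 =
  subst (ℚ._≤ ∑ℚ.sum f) (∑ℚ.sum-replicate-zero m) (sumℚ-mono-≤ {f = λ _ → 0ℚ} f≥0)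

term≤sumℚ : ∀ {m} {f : Fin m → ℚ} → (∀ i → 0ℚ ℚ.≤ f i) → ∀ i → f i ℚ.≤ ∑ℚ.sum f
term≤sumℚ {suc m} {f} f≥0 zero = begin
  f zero                   ≡⟨ sym (ℚP.+-identityʳ (f zero)) ⟩
  f zero ℚ.+ 0ℚ            ≤⟨ ℚP.+-monoʳ-≤ (f zero) (sumℚ-nonneg (f≥0 ∘ suc)) ⟩
  ∑ℚ.sum f                 ∎
  where open ℚP.≤-Reasoning
term≤sumℚ {suc m} {f} f≥0 (suc i) = begin
  f (suc i)                 ≤⟨ term≤sumℚ (f≥0 ∘ suc) i ⟩
  ∑ℚ.sum (f ∘ suc)          ≡⟨ sym (ℚP.+-identityˡ _) ⟩
  0ℚ ℚ.+ ∑ℚ.sum (f ∘ suc)   ≤⟨ ℚP.+-monoˡ-≤ _ (f≥0 zero) ⟩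
  ∑ℚ.sum f                  ∎
  where open ℚP.≤-Reasoning

sum-homomorphic : (h : ℕ → ℚ) → h 0 ≡ 0ℚ → (∀ x y → h (x + y) ≡ h x ℚ.+ h y) →
                  ∀ {m} (f : Fin m → ℕ) → ∑ℚ.sum (h ∘ f) ≡ h (sum f)
sum-homomorphic h h-0 h-+ {zero}  f = sym h-0
sum-homomorphic h h-0 h-+ {suc m} f =
  trans (cong (h (f zero) ℚ.+_) (sum-homomorphic h h-0 h-+ (f ∘ suc))) (sym (h-+ (f zero) _))

-- Rational weights and weak duality

ℕtoℚ≡mkℚ : ∀ r → ℕtoℚ r ≡ mkℚ (ℤ.+ r) 0 (Coprime.sym (Coprime.1-coprimeTo r))
ℕtoℚ≡mkℚ r = ℚP.normalize-coprime _

ℕtoℚ-+ : ∀ a b → ℕtoℚ (a + b) ≡ ℕtoℚ a ℚ.+ ℕtoℚ b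
ℕtoℚ-+ a b rewrite ℕtoℚ≡mkℚ a | ℕtoℚ≡mkℚ b =
  cong (ℚ._/ 1) (sym (cong₂ ℤ._+_ (ℤP.*-identityʳ (ℤ.+ a)) (ℤP.*-identityʳ (ℤ.+ b))))

ℕtoℚ-* : ∀ a b → ℕtoℚ (a * b) ≡ ℕtoℚ a ℚ.* ℕtoℚ b
ℕtoℚ-* a b rewrite ℕtoℚ≡mkℚ a | ℕtoℚ≡mkℚ b = cong (ℚ._/ 1) (ℤP.pos-* a b)

ℕtoℚ-mono-≤ : ∀ {a b} → a ≤ b → ℕtoℚ a ℚ.≤ ℕtoℚ b
ℕtoℚ-mono-≤ {a} {b} a≤b rewrite ℕtoℚ≡mkℚ a | ℕtoℚ≡mkℚ b =
  ℚ.*≤* (subst₂ ℤ._≤_ (sym (ℤP.*-identityʳ (ℤ.+ a))) (sym (ℤP.*-identityʳ (ℤ.+ b))) (ℤ.+≤+ a≤b))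

ℕtoℚ-cancel-≤ : ∀ {a b} → ℕtoℚ a ℚ.≤ ℕtoℚ b → a ≤ b
ℕtoℚ-cancel-≤ {a} {b} q≤q′ rewrite ℕtoℚ≡mkℚ a | ℕtoℚ≡mkℚ b with q≤q′
... | ℚ.*≤* z≤z′ =
  ℤP.drop‿+≤+ (subst₂ ℤ._≤_ (ℤP.*-identityʳ (ℤ.+ a)) (ℤP.*-identityʳ (ℤ.+ b)) z≤z′)

half : ℕ → ℚ
half x = ℕtoℚ x ℚ.* ½

half-+ : ∀ x y → half (x + y) ≡ half x ℚ.+ half y
half-+ x y = trans (cong (ℚ._* ½) (ℕtoℚ-+ x y)) (ℚP.*-distribʳ-+ ½ (ℕtoℚ x) (ℕtoℚ y))

half-mono-≤ : ∀ {x y} → x ≤ y → half x ℚ.≤ half y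
half-mono-≤ x≤y = ℚP.*-monoʳ-≤-nonNeg ½ (ℕtoℚ-mono-≤ x≤y)

half-double : ∀ x → half (2 * x) ≡ ℕtoℚ x
half-double x = begin
  ℕtoℚ (2 * x) ℚ.* ½          ≡⟨ cong (ℚ._* ½) (trans (cong ℕtoℚ (ℕP.*-comm 2 x)) (ℕtoℚ-* x 2)) ⟩
  ℕtoℚ x ℚ.* ℕtoℚ 2 ℚ.* ½     ≡⟨ ℚP.*-assoc (ℕtoℚ x) (ℕtoℚ 2) ½ ⟩
  ℕtoℚ x ℚ.* 1ℚ               ≡⟨ ℚP.*-identityʳ (ℕtoℚ x) ⟩
  ℕtoℚ x                      ∎
  where open ≡-Reasoning

sum-ℕtoℚ : ∀ {m} (f : Fin m → ℕ) → ∑ℚ.sum (ℕtoℚ ∘ f) ≡ ℕtoℚ (sum f)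
sum-ℕtoℚ = sum-homomorphic ℕtoℚ refl ℕtoℚ-+

sum-half : ∀ {m} (f : Fin m → ℕ) → ∑ℚ.sum (half ∘ f) ≡ half (sum f)
sum-half = sum-homomorphic half refl half-+

weak-duality : ∀ G {w f} → IsFracMultipacking G w → Dominating G f → weight G w ℚ.≤ ℕtoℚ (cost G f)
weak-duality G {w} {f} (w≥0 , w-packing) f-dominating = begin
  weight G w                                   ≡⟨ weight≡sum G w ⟩
  ∑ℚ.sum w                                     ≤⟨ sumℚ-mono-≤ heard-weight ⟩
  ∑ℚ.sum (λ u → ∑ℚ.sum (λ v → share v u))      ≡⟨ ∑ℚ.∑-comm (λ u v → share v u) ⟩
  ∑ℚ.sum (λ v → ∑ℚ.sum (share v))              ≤⟨ sumℚ-mono-≤ (λ v → load (f v) v) ⟩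
  ∑ℚ.sum (ℕtoℚ ∘ f)                            ≡⟨ sum-ℕtoℚ f ⟩
  ℕtoℚ (sum f)                                 ≡⟨ cong ℕtoℚ (sym (cost≡sum G f)) ⟩
  ℕtoℚ (cost G f)                              ∎
  where
  open ℚP.≤-Reasoning

  hears : ℕ → Vertex G → Vertex G → Bool
  hears r v u = (0 <ᵇ r) ∧ within G r v u

  share : Vertex G → Vertex G → ℚ
  share v u = if hears (f v) v u then w u else 0ℚ

  share≥0 : ∀ u v → 0ℚ ℚ.≤ share v u
  share≥0 u v with hears (f v) v u
  ... | true  = w≥0 u
  ... | false = ℚP.≤-refl

  heard-weight : ∀ u → w u ℚ.≤ ∑ℚ.sum (λ v → share v u)
  heard-weight u with f-dominating u
  ... | v , 0<fv , u∼v = subst (ℚ._≤ _) (if-T {b = hears (f v) v u} heard) (term≤sumℚ (share≥0 u) v)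
    where
    heard : T (hears (f v) v u)
    heard = from BoolP.T-∧ (ℕP.<⇒<ᵇ 0<fv , Reach.reached (reach-sym (toReach G (f v) u v u∼v)))

  load : ∀ r v → ∑ℚ.sum (λ u → if hears r v u then w u else 0ℚ) ℚ.≤ ℕtoℚ r
  load zero    v = ℚP.≤-reflexive (∑ℚ.sum-replicate-zero (n G))
  load (suc r) v = subst (ℚ._≤ ℕtoℚ (suc r)) (sumℚ-tabulate (λ u → if within G (suc r) v u then w u else 0ℚ) id)
                     (w-packing v (suc r) (s≤s z≤n))

duality-certificate : ∀ G {w f g} → IsFracMultipacking G w → IsBroadcast G f → Dominating G f →
                      weight G w ≡ ℕtoℚ g → cost G f ≡ g →
                      FracMultipackingNumber G (ℕtoℚ g) × BroadcastDomNumber G g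
duality-certificate G {w} {f} {g} w-frac f-broadcast f-dominating w≡g f≡g =
  ( (w , w-frac , w≡g)
  , λ w′ w′-frac → subst (weight G w′ ℚ.≤_) (cong ℕtoℚ f≡g) (weak-duality G w′-frac f-dominating) ) ,
  ( (f , f-broadcast , f-dominating , f≡g)
  , λ f′ _ f′-dominating →
      ℕtoℚ-cancel-≤ (subst (ℚ._≤ ℕtoℚ (cost G f′)) w≡g (weak-duality G w-frac f′-dominating)) )

ball : ∀ {G} → Distance G → (Vertex G → ℕ) → Vertex G → ℕ → ℕ
ball D ω v r = sum (λ u → if Distance.d D v u ≤ᵇ r then ω u else 0)

module _ {G} (D : Distance G) (ω : Vertex G → ℕ) where
  open Distance D

  ball≤sum : ∀ v r → ball D ω v r ≤ sum ω
  ball≤sum v r = sum-mono-≤ λ u → if≤ (d v u ≤ᵇ r)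
    where
    if≤ : ∀ b {x} → (if b then x else 0) ≤ x
    if≤ true  = ℕP.≤-refl
    if≤ false = z≤n

  ball-full : ∀ v r → (∀ u → d v u ≤ r) → ball D ω v r ≡ sum ω
  ball-full v r d≤r = sum-cong-≗ λ u → if-T (ℕP.≤⇒≤ᵇ (d≤r u))

card-ball : ∀ {G} (D : Distance G) M v r → card G (λ u → M u ∧ within G r v u) ≡ ball D (𝟙 ∘ M) v r
card-ball {G} D M v r = trans (card≡sum G _) (sum-cong-≗ λ u →
  trans (cong (λ b → 𝟙 (M u ∧ b)) (Distance.within≡d≤ᵇ D r v u)) (𝟙-∧ (M u) _))
  where
  𝟙-∧ : ∀ a b → 𝟙 (a ∧ b) ≡ (if b then 𝟙 a else 0)
  𝟙-∧ a true  = cong 𝟙 (BoolP.∧-identityʳ a)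
  𝟙-∧ a false = cong 𝟙 (BoolP.∧-zeroʳ a)

ball-cong : ∀ {G} (D : Distance G) {ω ω′} → ω ≗ ω′ → ∀ v r → ball D ω v r ≡ ball D ω′ v r
ball-cong D {ω} ω≗ω′ v r = sum-cong-≗ λ u → cong (if Distance.d D v u ≤ᵇ r then_else 0) (ω≗ω′ u)

multipacking-from-balls : ∀ {G} (D : Distance G) M → (∀ v r → 1 ≤ r → ball D (𝟙 ∘ M) v r ≤ r) →
                          IsMultipacking G M
multipacking-from-balls D M balls v r 1≤r = subst (_≤ r) (sym (card-ball D M v r)) (balls v r 1≤r)

fractional-from-balls : ∀ {G} (D : Distance G) ω → (∀ v r → 1 ≤ r → ball D ω v r ≤ 2 * r) →
                        IsFracMultipacking G (half ∘ ω)
fractional-from-balls {G} D ω balls = (λ v → half-mono-≤ {0} {ω v} z≤n) , λ v r 1≤r → begin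
  sumℚ (λ u → if within G r v u then half (ω u) else 0ℚ) (allFin (n G))
    ≡⟨ sumℚ-tabulate (λ u → if within G r v u then half (ω u) else 0ℚ) id ⟩
  ∑ℚ.sum (λ u → if within G r v u then half (ω u) else 0ℚ)
    ≡⟨ ∑ℚ.sum-cong-≗ (λ u → sym (BoolP.if-float half (within G r v u))) ⟩
  ∑ℚ.sum (λ u → half (if within G r v u then ω u else 0))
    ≡⟨ sum-half (λ u → if within G r v u then ω u else 0) ⟩
  half (sum (λ u → if within G r v u then ω u else 0))
    ≡⟨ cong half (sum-cong-≗ λ u → cong (if_then ω u else 0) (Distance.within≡d≤ᵇ D r v u)) ⟩
  half (ball D ω v r)
    ≤⟨ half-mono-≤ (balls v r 1≤r) ⟩
  half (2 * r)
    ≡⟨ half-double r ⟩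
  ℕtoℚ r
    ∎
  where open ℚP.≤-Reasoning

module _ {G} (D : Distance G) where
  open Distance D

  double-cover : ∀ {M} → (∀ c → ball D (𝟙 ∘ M) c 1 ≤ 1) →
                 ∀ (S : Vertex G → Bool) {k} (cover : Fin k → Vertex G) →
                 (∀ u → T (S u) → 2 ≤ sum (λ i → 𝟙 (d (cover i) u ≤ᵇ 1))) →
                 2 * sum (λ u → 𝟙 (M u ∧ S u)) ≤ k
  double-cover {M} packing S {k} cover twice = begin
    2 * sum (𝟙 ∘ M∩S)                               ≡⟨ cong (sum (𝟙 ∘ M∩S) +_) (ℕP.+-identityʳ _) ⟩
    sum (𝟙 ∘ M∩S) + sum (𝟙 ∘ M∩S)                   ≡⟨ ∑-distrib-+ (𝟙 ∘ M∩S) (𝟙 ∘ M∩S) ⟨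
    sum (λ u → 𝟙 (M∩S u) + 𝟙 (M∩S u))               ≤⟨ sum-mono-≤ counted-twice ⟩
    sum (λ u → sum (λ i → near i u))                ≡⟨ ∑-comm (λ u i → near i u) ⟩
    sum (λ i → ball D (𝟙 ∘ M) (cover i) 1)          ≤⟨ sum-≤-* 1 (packing ∘ cover) ⟩
    k * 1                                           ≡⟨ ℕP.*-identityʳ k ⟩
    k                                               ∎
    where
    open ℕP.≤-Reasoning
    M∩S : Vertex G → Bool
    M∩S u = M u ∧ S u
    near : Fin k → Vertex G → ℕ
    near i u = if d (cover i) u ≤ᵇ 1 then 𝟙 (M u) else 0
    counted-twice : ∀ u → 𝟙 (M∩S u) + 𝟙 (M∩S u) ≤ sum (λ i → near i u)
    counted-twice u with M u | S u in Su
    ... | false | _     = z≤n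
    ... | true  | false = z≤n
    ... | true  | true  = twice u (from BoolP.T-≡ Su)

2*m≤1+2*n⇒m≤n : ∀ {x b} → 2 * x ≤ suc (2 * b) → x ≤ b
2*m≤1+2*n⇒m≤n {x} {b} 2x≤2b+1 = ℕP.≤-pred (ℕP.*-cancelˡ-< 2 x (suc b)
  (ℕP.≤-trans (s≤s 2x≤2b+1) (ℕP.≤-reflexive (sym (ℕP.*-suc 2 b)))))

-- Gluing two graphs along a bridge

-- Seen from a vertex at distance c from one end of a bridge: the weight within r beyond the bridge,
-- when P t is the weight within t of its other end.
across : ℕ → (ℕ → ℕ) → ℕ → ℕ
across c P r = if c <ᵇ r then P (r ∸ suc c) else 0

≤ᵇ-across : ∀ c δ r → (c + suc δ ≤ᵇ r) ≡ (c <ᵇ r) ∧ (δ ≤ᵇ r ∸ suc c)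
≤ᵇ-across c δ r = T-extensional
  (λ h → let c+1+δ≤r = ℕP.≤ᵇ⇒≤ _ _ h in from BoolP.T-∧
    ( ℕP.<⇒<ᵇ (ℕP.<-≤-trans (ℕP.m<m+n c (s≤s z≤n)) c+1+δ≤r)
    , ℕP.≤⇒≤ᵇ (ℕP.m+n≤o⇒m≤o∸n δ (subst (_≤ r) reorder c+1+δ≤r)) ))
  (λ h → let c<r , δ≤ = to BoolP.T-∧ h in ℕP.≤⇒≤ᵇ
    (subst (_≤ r) (sym reorder) (ℕP.m≤o∸n⇒m+n≤o δ (ℕP.<ᵇ⇒< c r c<r) (ℕP.≤ᵇ⇒≤ _ _ δ≤))))
  where
  reorder : c + suc δ ≡ δ + suc c
  reorder = trans (ℕP.+-suc c δ) (ℕP.+-comm (suc c) δ)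

sum-across : ∀ {m} c r (δ ω : Fin m → ℕ) →
             sum (λ y → if c + suc (δ y) ≤ᵇ r then ω y else 0) ≡
             across c (λ t → sum (λ y → if δ y ≤ᵇ t then ω y else 0)) r
sum-across {m} c r δ ω =
  trans (sum-cong-≗ λ y → cong (if_then ω y else 0) (≤ᵇ-across c (δ y) r)) (by-cases (c <ᵇ r))
  where
  by-cases : ∀ b → sum (λ y → if b ∧ (δ y ≤ᵇ r ∸ suc c) then ω y else 0) ≡
                   (if b then sum (λ y → if δ y ≤ᵇ r ∸ suc c then ω y else 0) else 0)
  by-cases true  = refl
  by-cases false = sum-replicate-zero m

across-on : ∀ {c r} P → c < r → across c P r ≡ P (r ∸ suc c)
across-on P c<r = if-T (ℕP.<⇒<ᵇ c<r)

across-off : ∀ {c r} P → r ≤ c → across c P r ≡ 0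
across-off {c} {r} P r≤c = if-F (λ c<ᵇr → ℕP.<⇒≱ (ℕP.<ᵇ⇒< c r c<ᵇr) r≤c)

across-mono : ∀ c {P Q} → (∀ t → P t ≤ Q t) → ∀ r → across c P r ≤ across c Q r
across-mono c P≤Q r with c <ᵇ r
... | true  = P≤Q _
... | false = z≤n

across-cong : ∀ c {P Q} → (∀ t → P t ≡ Q t) → ∀ r → across c P r ≡ across c Q r
across-cong c P≗Q r = cong (if c <ᵇ r then_else 0) (P≗Q (r ∸ suc c))

across-+ : ∀ c P Q r → across c P r + across c Q r ≡ across c (λ t → P t + Q t) r
across-+ c P Q r with c <ᵇ r
... | true  = refl
... | false = refl

across-across : ∀ c k P r → across (c + suc k) P r ≡ across c (across k P) r
across-across c k P r = begin
  (if c + suc k <ᵇ r then P (r ∸ suc (c + suc k)) else 0)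
    ≡⟨ cong (if_then P (r ∸ suc (c + suc k)) else 0)
            (trans (cong (_≤ᵇ r) (sym (ℕP.+-suc c (suc k)))) (≤ᵇ-across c (suc k) r)) ⟩
  (if (c <ᵇ r) ∧ (k <ᵇ r ∸ suc c) then P (r ∸ suc (c + suc k)) else 0)
    ≡⟨ cong (λ t → if (c <ᵇ r) ∧ (k <ᵇ r ∸ suc c) then P t else 0) (sym (ℕP.∸-+-assoc r (suc c) (suc k))) ⟩
  (if (c <ᵇ r) ∧ (k <ᵇ r ∸ suc c) then P (r ∸ suc c ∸ suc k) else 0)
    ≡⟨ BoolP.if-∧ (c <ᵇ r) ⟩
  across c (across k P) r
    ∎
  where open ≡-Reasoning

module Glue (A B : Graph) (a : Vertex A) (b : Vertex B) where

  Side : Set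
  Side = Vertex A ⊎ Vertex B

  bridge : Vertex A → Vertex B → Bool
  bridge x y = does (x Fin.≟ a) ∧ does (y Fin.≟ b)

  adjˢ : Side → Side → Bool
  adjˢ (inj₁ x) (inj₁ y) = adj A x y
  adjˢ (inj₂ x) (inj₂ y) = adj B x y
  adjˢ (inj₁ x) (inj₂ y) = bridge x y
  adjˢ (inj₂ y) (inj₁ x) = bridge x y

  adjˢ-sym : ∀ s t → adjˢ s t ≡ adjˢ t s
  adjˢ-sym (inj₁ x) (inj₁ y) = Graph.sym A x y
  adjˢ-sym (inj₂ x) (inj₂ y) = Graph.sym B x y
  adjˢ-sym (inj₁ x) (inj₂ y) = refl
  adjˢ-sym (inj₂ y) (inj₁ x) = refl

  adjˢ-irrefl : ∀ s → adjˢ s s ≡ false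
  adjˢ-irrefl (inj₁ x) = irrefl A x
  adjˢ-irrefl (inj₂ y) = irrefl B y

  side : Fin (n A + n B) → Side
  side = splitAt (n A)

  glued : Graph
  glued = record
    { n      = n A + n B
    ; adj    = λ i j → adjˢ (side i) (side j)
    ; sym    = λ i j → adjˢ-sym (side i) (side j)
    ; irrefl = λ i → adjˢ-irrefl (side i)
    }

  inl : Vertex A → Vertex glued
  inl x = x ↑ˡ n B

  inr : Vertex B → Vertex glued
  inr y = n A ↑ʳ y

  side-inl : ∀ x → side (inl x) ≡ inj₁ x
  side-inl x = FinP.splitAt-↑ˡ (n A) x (n B)

  side-inr : ∀ y → side (inr y) ≡ inj₂ y
  side-inr y = FinP.splitAt-↑ʳ (n A) (n B) y

  data View : Vertex glued → Set where
    left  : ∀ x → View (inl x)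
    right : ∀ y → View (inr y)

  view : ∀ i → View i
  view i with side i in eq
  ... | inj₁ x = subst View (FinP.splitAt⁻¹-↑ˡ eq) (left x)
  ... | inj₂ y = subst View (FinP.splitAt⁻¹-↑ʳ eq) (right y)

  edge-inl : ∀ {x y} → Edge A x y → Edge glued (inl x) (inl y)
  edge-inl {x} {y} e rewrite side-inl x | side-inl y = e

  edge-inr : ∀ {x y} → Edge B x y → Edge glued (inr x) (inr y)
  edge-inr {x} {y} e rewrite side-inr x | side-inr y = e

  edge-bridge : Edge glued (inl a) (inr b)
  edge-bridge rewrite side-inl a | side-inr b =
    to BoolP.T-≡ (from BoolP.T-∧ (T-does⁺ (a Fin.≟ a) refl , T-does⁺ (b Fin.≟ b) refl))

  bridge-ends : ∀ x y → bridge x y ≡ true → x ≡ a × y ≡ b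
  bridge-ends x y h = let x≟a , y≟b = to BoolP.T-∧ (from BoolP.T-≡ h) in
                      T-does⁻ (x Fin.≟ a) x≟a , T-does⁻ (y Fin.≟ b) y≟b

  sum-glued : ∀ (f : Vertex glued → ℕ) → sum f ≡ sum (f ∘ inl) + sum (f ∘ inr)
  sum-glued = sum-↑ (n A)

  module GluedDistance (DA : Distance A) (DB : Distance B) where
    open Distance DA using () renaming (d to dA)
    open Distance DB using () renaming (d to dB)

    dˢ : Side → Side → ℕ
    dˢ (inj₁ x) (inj₁ y) = dA x y
    dˢ (inj₁ x) (inj₂ y) = dA x a + suc (dB b y)
    dˢ (inj₂ x) (inj₁ y) = dB x b + suc (dA a y)
    dˢ (inj₂ x) (inj₂ y) = dB x y

    reachˢ : ∀ s t → Reach glued (dˢ s t) (join (n A) (n B) s) (join (n A) (n B) t)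
    reachˢ (inj₁ x) (inj₁ y) = reach-map inl edge-inl (Distance.reach-d DA x y)
    reachˢ (inj₂ x) (inj₂ y) = reach-map inr edge-inr (Distance.reach-d DB x y)
    reachˢ (inj₁ x) (inj₂ y) = reach-trans (reach-map inl edge-inl (Distance.reach-d DA x a))
                                 (reach-step edge-bridge (reach-map inr edge-inr (Distance.reach-d DB b y)))
    reachˢ (inj₂ x) (inj₁ y) = reach-trans (reach-map inr edge-inr (Distance.reach-d DB x b))
                                 (reach-step (trans (Graph.sym glued (inr b) (inl a)) edge-bridge)
                                   (reach-map inl edge-inl (Distance.reach-d DA a y)))

    dˢ-self : ∀ s → dˢ s s ≡ 0
    dˢ-self (inj₁ x) = Distance.d-self DA x
    dˢ-self (inj₂ y) = Distance.d-self DB y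

    dˢ-edge : ∀ s t u → adjˢ t u ≡ true → dˢ s u ≤ suc (dˢ s t)
    dˢ-edge (inj₁ x) (inj₁ y) (inj₁ z) e = Distance.d-edge DA x e
    dˢ-edge (inj₂ x) (inj₂ y) (inj₂ z) e = Distance.d-edge DB x e
    dˢ-edge (inj₁ x) (inj₂ y) (inj₂ z) e =
      subst (dA x a + suc (dB b z) ≤_) (ℕP.+-suc (dA x a) (suc (dB b y)))
            (ℕP.+-monoʳ-≤ (dA x a) (s≤s (Distance.d-edge DB b e)))
    dˢ-edge (inj₂ x) (inj₁ y) (inj₁ z) e =
      subst (dB x b + suc (dA a z) ≤_) (ℕP.+-suc (dB x b) (suc (dA a y)))
            (ℕP.+-monoʳ-≤ (dB x b) (s≤s (Distance.d-edge DA a e)))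
    dˢ-edge (inj₁ x) (inj₁ y) (inj₂ z) e with refl , refl ← bridge-ends y z e
      rewrite Distance.d-self DB b = ℕP.≤-reflexive (ℕP.+-comm (dA x a) 1)
    dˢ-edge (inj₂ x) (inj₂ y) (inj₁ z) e with refl , refl ← bridge-ends z y e
      rewrite Distance.d-self DA a = ℕP.≤-reflexive (ℕP.+-comm (dB x b) 1)
    dˢ-edge (inj₁ x) (inj₂ y) (inj₁ z) e with refl , refl ← bridge-ends z y e =
      ℕP.m≤n⇒m≤1+n (ℕP.m≤m+n (dA x a) _)
    dˢ-edge (inj₂ x) (inj₁ y) (inj₂ z) e with refl , refl ← bridge-ends y z e =
      ℕP.m≤n⇒m≤1+n (ℕP.m≤m+n (dB x b) _)

    -- dˢ is realised by walks and grows by at most one along every edge, so it is the distance.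
    distance : Distance glued
    distance = record
      { d         = λ i j → dˢ (side i) (side j)
      ; reach-d   = λ i j → subst₂ (Reach glued _) (FinP.join-splitAt (n A) (n B) i) (FinP.join-splitAt (n A) (n B) j)
                                   (reachˢ (side i) (side j))
      ; d-minimal = λ {r} {i} h → subst (_ ≤_) (trans (cong (r +_) (dˢ-self (side i))) (ℕP.+-identityʳ r))
                                    (reach-lipschitz (dˢ (side i) ∘ side)
                                                     (λ {y} {z} → dˢ-edge (side i) (side y) (side z)) h)
      }

    open Distance distance public using (d)

    d-inl-inl : ∀ x y → d (inl x) (inl y) ≡ dA x y
    d-inl-inl x y rewrite side-inl x | side-inl y = refl

    d-inl-inr : ∀ x y → d (inl x) (inr y) ≡ dA x a + suc (dB b y)
    d-inl-inr x y rewrite side-inl x | side-inr y = refl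

    d-inr-inl : ∀ x y → d (inr x) (inl y) ≡ dB x b + suc (dA a y)
    d-inr-inl x y rewrite side-inr x | side-inl y = refl

    d-inr-inr : ∀ x y → d (inr x) (inr y) ≡ dB x y
    d-inr-inr x y rewrite side-inr x | side-inr y = refl

    private
      term-cong : ∀ {r δ δ′ w w′} → δ ≡ δ′ → w ≡ w′ →
                  (if δ ≤ᵇ r then w else 0) ≡ (if δ′ ≤ᵇ r then w′ else 0)
      term-cong refl refl = refl

    ball-inl : ∀ ωA ωB x r → ball distance (ωA ++ ωB) (inl x) r ≡ ball DA ωA x r + across (dA x a) (ball DB ωB b) r
    ball-inl ωA ωB x r = trans (sum-glued _) (cong₂ _+_
      (sum-cong-≗ λ y → term-cong (d-inl-inl x y) (lookup-++ˡ ωA ωB y))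
      (trans (sum-cong-≗ λ z → term-cong (d-inl-inr x z) (lookup-++ʳ ωA ωB z)) (sum-across (dA x a) r (dB b) ωB)))

    ball-inr : ∀ ωA ωB y r → ball distance (ωA ++ ωB) (inr y) r ≡ across (dB y b) (ball DA ωA a) r + ball DB ωB y r
    ball-inr ωA ωB y r = trans (sum-glued _) (cong₂ _+_
      (trans (sum-cong-≗ λ x → term-cong (d-inr-inl y x) (lookup-++ˡ ωA ωB x)) (sum-across (dB y b) r (dA a) ωA))
      (sum-cong-≗ λ z → term-cong (d-inr-inr y z) (lookup-++ʳ ωA ωB z)))

    ball-restrictˡ : ∀ ω x r → ball DA (ω ∘ inl) x r ≤ ball distance ω (inl x) r
    ball-restrictˡ ω x r = subst (_≤ ball distance ω (inl x) r)
      (sum-cong-≗ λ y → term-cong (d-inl-inl x y) refl)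
      (subst (sum (λ y → if d (inl x) (inl y) ≤ᵇ r then ω (inl y) else 0) ≤_) (sym (sum-glued _)) (ℕP.m≤m+n _ _))

    ball-restrictʳ : ∀ ω y r → ball DB (ω ∘ inr) y r ≤ ball distance ω (inr y) r
    ball-restrictʳ ω y r = subst (_≤ ball distance ω (inr y) r)
      (sum-cong-≗ λ z → term-cong (d-inr-inr y z) refl)
      (subst (sum (λ z → if d (inr y) (inr z) ≤ᵇ r then ω (inr z) else 0) ≤_) (sym (sum-glued _)) (ℕP.m≤n+m _ _))

    card-glued : ∀ M → card glued M ≡ card A (M ∘ inl) + card B (M ∘ inr)
    card-glued M = trans (card≡sum glued M)
                         (trans (sum-glued _) (sym (cong₂ _+_ (card≡sum A (M ∘ inl)) (card≡sum B (M ∘ inr)))))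

    multipacking-inl : ∀ {M} → IsMultipacking glued M → IsMultipacking A (M ∘ inl)
    multipacking-inl {M} M-mp v r 1≤r = begin
      card A (λ x → M (inl x) ∧ within A r v x)             ≡⟨ card-ball DA (M ∘ inl) v r ⟩
      ball DA (𝟙 ∘ M ∘ inl) v r                             ≤⟨ ball-restrictˡ (𝟙 ∘ M) v r ⟩
      ball distance (𝟙 ∘ M) (inl v) r                       ≡⟨ card-ball distance M (inl v) r ⟨
      card glued (λ u → M u ∧ within glued r (inl v) u)     ≤⟨ M-mp (inl v) r 1≤r ⟩
      r                                                     ∎
      where open ℕP.≤-Reasoning

    multipacking-inr : ∀ {M} → IsMultipacking glued M → IsMultipacking B (M ∘ inr)
    multipacking-inr {M} M-mp v r 1≤r = begin
      card B (λ y → M (inr y) ∧ within B r v y)             ≡⟨ card-ball DB (M ∘ inr) v r ⟩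
      ball DB (𝟙 ∘ M ∘ inr) v r                             ≤⟨ ball-restrictʳ (𝟙 ∘ M) v r ⟩
      ball distance (𝟙 ∘ M) (inr v) r                       ≡⟨ card-ball distance M (inr v) r ⟨
      card glued (λ u → M u ∧ within glued r (inr v) u)     ≤⟨ M-mp (inr v) r 1≤r ⟩
      r                                                     ∎
      where open ℕP.≤-Reasoning

  dominating-++ : ∀ {f g} → Dominating A f → Dominating B g → Dominating glued (f ++ g)
  dominating-++ {f} {g} f-dom g-dom u with view u
  ... | left x = let v , 0<fv , x∼v = f-dom x in
    inl v , subst (0 <_) (sym (lookup-++ˡ f g v)) 0<fv ,
    subst (λ r → Dist≤ glued r (inl x) (inl v)) (sym (lookup-++ˡ f g v))
      (Reach.dist≤ (reach-map inl edge-inl (toReach A (f v) x v x∼v)))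
  ... | right y = let v , 0<gv , y∼v = g-dom y in
    inr v , subst (0 <_) (sym (lookup-++ʳ f g v)) 0<gv ,
    subst (λ r → Dist≤ glued r (inr y) (inr v)) (sym (lookup-++ʳ f g v))
      (Reach.dist≤ (reach-map inr edge-inr (toReach B (g v) y v y∼v)))

  module GluedPEO (PA : PerfectEliminationOrder A) (PB : PerfectEliminationOrder B)
                  (b-last : ∀ y → PerfectEliminationOrder.rank PB y ≤ PerfectEliminationOrder.rank PB b) where
    open PerfectEliminationOrder PA using ()
      renaming (rank to rankA; rank-injective to rankA-injective; simplicial to simplicialA)
    open PerfectEliminationOrder PB using ()
      renaming (rank to rankB; rank-injective to rankB-injective; simplicial to simplicialB)

    -- B is eliminated first, ending with b: then the later neighbours of a vertex all lie on its
    -- own side, except for b, whose only later neighbour is a.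
    rankˢ : Side → ℕ
    rankˢ (inj₁ x) = suc (rankB b) + rankA x
    rankˢ (inj₂ y) = rankB y

    B-before-A : ∀ x y → rankB y < suc (rankB b) + rankA x
    B-before-A x y = ℕP.≤-trans (s≤s (b-last y)) (ℕP.m≤m+n _ _)

    rankˢ-injective : ∀ {s t} → rankˢ s ≡ rankˢ t → s ≡ t
    rankˢ-injective {inj₁ x} {inj₁ y} eq = cong inj₁ (rankA-injective (ℕP.+-cancelˡ-≡ _ _ _ eq))
    rankˢ-injective {inj₂ x} {inj₂ y} eq = cong inj₂ (rankB-injective eq)
    rankˢ-injective {inj₁ x} {inj₂ y} eq = ⊥-elim (ℕP.<⇒≢ (B-before-A x y) (sym eq))
    rankˢ-injective {inj₂ y} {inj₁ x} eq = ⊥-elim (ℕP.<⇒≢ (B-before-A x y) eq)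

    simplicialˢ : ∀ s t u → adjˢ s t ≡ true → adjˢ s u ≡ true → rankˢ s < rankˢ t → rankˢ s < rankˢ u → t ≢ u →
                  adjˢ t u ≡ true
    simplicialˢ (inj₁ x) (inj₁ y) (inj₁ z) e₁ e₂ <₁ <₂ y≢z =
      simplicialA e₁ e₂ (ℕP.+-cancelˡ-< _ _ _ <₁) (ℕP.+-cancelˡ-< _ _ _ <₂) (y≢z ∘ cong inj₁)
    simplicialˢ (inj₂ x) (inj₂ y) (inj₂ z) e₁ e₂ <₁ <₂ y≢z =
      simplicialB e₁ e₂ <₁ <₂ (y≢z ∘ cong inj₂)
    simplicialˢ (inj₁ x) (inj₂ y) u e₁ e₂ <₁ <₂ _ = ⊥-elim (ℕP.<-asym <₁ (B-before-A x y))
    simplicialˢ (inj₁ x) (inj₁ y) (inj₂ z) e₁ e₂ <₁ <₂ _ = ⊥-elim (ℕP.<-asym <₂ (B-before-A x z))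
    simplicialˢ (inj₂ x) (inj₁ y) (inj₁ z) e₁ e₂ <₁ <₂ y≢z
      with refl , _ ← bridge-ends y x e₁ | refl , _ ← bridge-ends z x e₂ = ⊥-elim (y≢z refl)
    simplicialˢ (inj₂ x) (inj₁ y) (inj₂ z) e₁ e₂ <₁ <₂ _
      with refl , refl ← bridge-ends y x e₁ = ⊥-elim (ℕP.<⇒≱ <₂ (b-last z))
    simplicialˢ (inj₂ x) (inj₂ z) (inj₁ y) e₁ e₂ <₁ <₂ _
      with refl , refl ← bridge-ends y x e₂ = ⊥-elim (ℕP.<⇒≱ <₁ (b-last z))

    side-injective : ∀ {i j} → side i ≡ side j → i ≡ j
    side-injective {i} {j} eq = trans (sym (FinP.join-splitAt (n A) (n B) i))
                                      (trans (cong (join (n A) (n B)) eq) (FinP.join-splitAt (n A) (n B) j))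

    peo : PerfectEliminationOrder glued
    peo = record
      { rank           = rankˢ ∘ side
      ; rank-injective = side-injective ∘ rankˢ-injective
      ; simplicial     = λ {v} {u} {w} e₁ e₂ <₁ <₂ u≢w →
                           simplicialˢ (side v) (side u) (side w) e₁ e₂ <₁ <₂ (u≢w ∘ side-injective)
      }

-- Chains of copies of a unit

-- chain j consists of j + 1 copies of U, the exit of each copy joined to the entry of the next.
module Chain (U : Graph) (DU : Distance U) (entry exit : Vertex U) where
  open Distance DU using () renaming (d to dU)

  mutual
    chain : ℕ → Graph
    chain zero    = U
    chain (suc j) = Glue.glued (chain j) U (end j) entry

    end : ∀ j → Vertex (chain j)
    end zero    = exit
    end (suc j) = Glue.inr (chain j) U (end j) entry exit

  module Link (j : ℕ) = Glue (chain j) U (end j) entry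

  distance : ∀ j → Distance (chain j)
  distance zero    = DU
  distance (suc j) = Link.GluedDistance.distance j (distance j) DU

  module LinkDistance (j : ℕ) = Link.GluedDistance j (distance j) DU

  chain-peo : (P : PerfectEliminationOrder U) →
              (∀ y → PerfectEliminationOrder.rank P y ≤ PerfectEliminationOrder.rank P entry) →
              ∀ j → PerfectEliminationOrder (chain j)
  chain-peo P entry-last zero    = P
  chain-peo P entry-last (suc j) = Link.GluedPEO.peo j (chain-peo P entry-last j) P entry-last

  repeat : ∀ {X : Set} → (Vertex U → X) → ∀ j → Vertex (chain j) → X
  repeat f zero    = f
  repeat f (suc j) = repeat f j ++ f

  repeat-map : ∀ {X Y : Set} (h : X → Y) (f : Vertex U → X) j → h ∘ repeat f j ≗ repeat (h ∘ f) j
  repeat-map h f zero    v = refl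
  repeat-map h f (suc j) v =
    trans ([,]-∘ h (splitAt (n (chain j)) v)) (++-cong (h ∘ repeat f j) _ (repeat-map h f j) (λ _ → refl) v)

  repeat-cong : ∀ {X : Set} {f g : Vertex U → X} → f ≗ g → ∀ j → repeat f j ≗ repeat g j
  repeat-cong f≗g zero    = f≗g
  repeat-cong f≗g (suc j) = ++-cong (repeat _ j) _ (repeat-cong f≗g j) f≗g

  repeat-image : ∀ {X : Set} (f : Vertex U → X) j v → ∃ λ u → repeat f j v ≡ f u
  repeat-image f zero    v = v , refl
  repeat-image f (suc j) v with splitAt (n (chain j)) v
  ... | inj₁ x = repeat-image f j x
  ... | inj₂ y = y , refl

  sum-repeat : ∀ ω j → sum (repeat ω j) ≡ suc j * sum ω
  sum-repeat ω zero    = sym (ℕP.+-identityʳ (sum ω))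
  sum-repeat ω (suc j) = begin
    sum (repeat ω j ++ ω)          ≡⟨ sum-++ (repeat ω j) ω ⟩
    sum (repeat ω j) + sum ω       ≡⟨ cong (_+ sum ω) (sum-repeat ω j) ⟩
    suc j * sum ω + sum ω          ≡⟨ ℕP.+-comm (suc j * sum ω) (sum ω) ⟩
    suc (suc j) * sum ω            ∎
    where open ≡-Reasoning

  dominating-repeat : ∀ {f} → Dominating U f → ∀ j → Dominating (chain j) (repeat f j)
  dominating-repeat f-dom zero    = f-dom
  dominating-repeat f-dom (suc j) = Link.dominating-++ j (dominating-repeat f-dom j) f-dom

  multipacking-bound : ∀ {m} → (∀ M → IsMultipacking U M → card U M ≤ m) →
                       ∀ j M → IsMultipacking (chain j) M → card (chain j) M ≤ suc j * m
  multipacking-bound {m} U-bound zero    M M-mp = subst (card U M ≤_) (sym (ℕP.+-identityʳ m)) (U-bound M M-mp)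
  multipacking-bound {m} U-bound (suc j) M M-mp = begin
    card (chain (suc j)) M
      ≡⟨ card-glued M ⟩
    card (chain j) (M ∘ inl) + card U (M ∘ inr)
      ≤⟨ ℕP.+-mono-≤ (multipacking-bound U-bound j _ (multipacking-inl M-mp)) (U-bound _ (multipacking-inr M-mp)) ⟩
    suc j * m + m
      ≡⟨ ℕP.+-comm (suc j * m) m ⟩
    suc (suc j) * m
      ∎
    where
    open ℕP.≤-Reasoning
    open Link j using (inl; inr)
    open LinkDistance j using (card-glued; multipacking-inl; multipacking-inr)

  δ : ℕ
  δ = dU entry exit

  -- Corresponding vertices of consecutive copies are p apart.
  p : ℕ
  p = suc δ

  far-pair : ∀ j → ∃ λ x → ∃ λ y → Distance.d (distance j) x y ≡ δ
  far-pair zero    = entry , exit , refl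
  far-pair (suc j) = Link.inr j entry , Link.inr j exit , LinkDistance.d-inr-inr j entry exit

  module BallBound (ω : Vertex U → ℕ) (mult : ℕ) where

    W : ℕ
    W = sum ω

    fromEntry fromExit : ℕ → ℕ
    fromEntry = ball DU ω entry
    fromExit  = ball DU ω exit

    -- Bounds the weight within t of the end of an arbitrarily long chain, given the profile P of a
    -- single copy seen from that end.
    periodic : (ℕ → ℕ) → ℕ → ℕ
    periodic P t = W * (t ÷ p) + P (t % p)

    periodic-small : ∀ P {t} → t < p → periodic P t ≡ P t
    periodic-small P {t} t<p rewrite m<n⇒m/n≡0 t<p | m<n⇒m%n≡m t<p | ℕP.*-zeroʳ W = refl

    periodic-step : ∀ P t → periodic P (t + p) ≡ W + periodic P t
    periodic-step P t = begin
      W * ((t + p) ÷ p) + P ((t + p) % p)   ≡⟨ cong₂ (λ q i → W * q + P i) quotient ([m+n]%n≡m%n t p) ⟩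
      W * suc (t ÷ p) + P (t % p)           ≡⟨ cong (_+ P (t % p)) (ℕP.*-suc W (t ÷ p)) ⟩
      W + W * (t ÷ p) + P (t % p)           ≡⟨ ℕP.+-assoc W _ _ ⟩
      W + periodic P t                      ∎
      where
      open ≡-Reasoning
      quotient : (t + p) ÷ p ≡ suc (t ÷ p)
      quotient = trans (m/n≡1+[m∸n]/n (ℕP.m≤n+m p t)) (cong (λ x → suc (x ÷ p)) (ℕP.m+n∸n≡m t p))

    across-periodic-step : ∀ P {c r} → c < r → across c (periodic P) (r + p) ≡ W + across c (periodic P) r
    across-periodic-step P {c} {r} c<r = begin
      across c (periodic P) (r + p)   ≡⟨ across-on (periodic P) (ℕP.<-≤-trans c<r (ℕP.m≤m+n r p)) ⟩
      periodic P (r + p ∸ suc c)      ≡⟨ cong (periodic P) (ℕP.+-∸-comm p c<r) ⟩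
      periodic P (r ∸ suc c + p)      ≡⟨ periodic-step P (r ∸ suc c) ⟩
      W + periodic P (r ∸ suc c)      ≡⟨ cong (W +_) (sym (across-on (periodic P) c<r)) ⟩
      W + across c (periodic P) r     ∎
      where open ≡-Reasoning

    absorb : ∀ P → (∀ t → P t ≤ W) → ∀ t → P t + across δ (periodic P) t ≤ periodic P t
    absorb P P≤W t with δ ℕP.<? t
    ... | yes δ<t = begin
      P t + across δ (periodic P) t   ≡⟨ cong (P t +_) (across-on (periodic P) δ<t) ⟩
      P t + periodic P (t ∸ p)        ≤⟨ ℕP.+-monoˡ-≤ _ (P≤W t) ⟩
      W + periodic P (t ∸ p)          ≡⟨ sym (periodic-step P (t ∸ p)) ⟩
      periodic P (t ∸ p + p)          ≡⟨ cong (periodic P) (ℕP.m∸n+n≡m δ<t) ⟩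
      periodic P t                    ∎
      where open ℕP.≤-Reasoning
    ... | no δ≮t = begin
      P t + across δ (periodic P) t   ≡⟨ cong (P t +_) (across-off (periodic P) t≤δ) ⟩
      P t + 0                         ≡⟨ ℕP.+-identityʳ (P t) ⟩
      P t                             ≡⟨ sym (periodic-small P (s≤s t≤δ)) ⟩
      periodic P t                    ∎
      where
      open ℕP.≤-Reasoning
      t≤δ : t ≤ δ
      t≤δ = ℕP.≮⇒≥ δ≮t

    -- Bounds the weight within r of y in the middle copy of a chain infinite in both directions.
    localTerm : Vertex U → ℕ → ℕ
    localTerm y r = across (dU y entry) (periodic fromExit) r + ball DU ω y r + across (dU y exit) (periodic fromEntry) r

    LocalBound : Set
    LocalBound = ∀ y r → 1 ≤ r → localTerm y r ≤ mult * r

    localTerm-via : ∀ (B : Vertex U → ℕ → ℕ) {W′} → (∀ x t → ball DU ω x t ≡ B x t) → W ≡ W′ → ∀ y r →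
                    localTerm y r ≡ across (dU y entry) (λ t → W′ * (t ÷ p) + B exit (t % p)) r + B y r
                                     + across (dU y exit) (λ t → W′ * (t ÷ p) + B entry (t % p)) r
    localTerm-via B ball≡B W≡W′ y r =
      cong₂ _+_ (cong₂ _+_ (across-cong (dU y entry) (periodic≡ exit) r) (ball≡B y r))
                (across-cong (dU y exit) (periodic≡ entry) r)
      where
      periodic≡ : ∀ x t → periodic (ball DU ω x) t ≡ _
      periodic≡ x t = cong₂ (λ w b → w * (t ÷ p) + b) W≡W′ (ball≡B x (t % p))

    fromEntry≤W : ∀ t → fromEntry t ≤ W
    fromEntry≤W = ball≤sum DU ω entry

    fromExit≤W : ∀ t → fromExit t ≤ W
    fromExit≤W = ball≤sum DU ω exit

    record Invariant (j : ℕ) : Set where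
      open Distance (distance j) using (d)
      field
        end-ball    : ∀ t → ball (distance j) (repeat ω j) (end j) t ≤ periodic fromExit t
        -- room is left for the copies still to be appended after end j
        with-future : ∀ v r → 1 ≤ r →
                      ball (distance j) (repeat ω j) v r + across (d v (end j)) (periodic fromEntry) r ≤ mult * r

    invariant-zero : LocalBound → Invariant 0
    invariant-zero local = record
      { end-ball    = λ t → ℕP.≤-trans (ℕP.m≤m+n (fromExit t) _) (absorb fromExit fromExit≤W t)
      ; with-future = λ v r 1≤r → ℕP.≤-trans (ℕP.+-monoˡ-≤ _ (ℕP.m≤n+m (ball DU ω v r) _)) (local v r 1≤r)
      }

    invariant-suc : LocalBound → ∀ {j} → Invariant j → Invariant (suc j)
    invariant-suc local {j} inv = record { end-ball = end-ball′ ; with-future = with-future′ }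
      where
      open Invariant inv
      open Link j using (inl; inr; view; left; right)
      open LinkDistance j using (d; ball-inl; ball-inr; d-inl-inr; d-inr-inr)
      open Distance (distance j) using () renaming (d to dA)
      ω′ : Vertex (chain (suc j)) → ℕ
      ω′ = repeat ω (suc j)
      F : ℕ → ℕ
      F = periodic fromEntry

      end-ball′ : ∀ t → ball (distance (suc j)) ω′ (inr exit) t ≤ periodic fromExit t
      end-ball′ t = begin
        ball (distance (suc j)) ω′ (inr exit) t
          ≡⟨ ball-inr (repeat ω j) ω exit t ⟩
        across (dU exit entry) (ball (distance j) (repeat ω j) (end j)) t + fromExit t
          ≤⟨ ℕP.+-monoˡ-≤ _ (across-mono _ end-ball t) ⟩
        across (dU exit entry) (periodic fromExit) t + fromExit t
          ≡⟨ cong (λ c → across c (periodic fromExit) t + fromExit t) (Distance.d-sym DU exit entry) ⟩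
        across δ (periodic fromExit) t + fromExit t
          ≡⟨ ℕP.+-comm _ (fromExit t) ⟩
        fromExit t + across δ (periodic fromExit) t
          ≤⟨ absorb fromExit fromExit≤W t ⟩
        periodic fromExit t
          ∎
        where open ℕP.≤-Reasoning

      with-future′ : ∀ v r → 1 ≤ r → ball (distance (suc j)) ω′ v r + across (d v (inr exit)) F r ≤ mult * r
      with-future′ v r 1≤r with view v
      ... | left x = begin
        ball (distance (suc j)) ω′ (inl x) r + across (d (inl x) (inr exit)) F r
          ≡⟨ cong₂ (λ B c → B + across c F r) (ball-inl (repeat ω j) ω x r) (d-inl-inr x exit) ⟩
        Bx + across c fromEntry r + across (c + suc δ) F r
          ≡⟨ ℕP.+-assoc Bx _ _ ⟩
        Bx + (across c fromEntry r + across (c + suc δ) F r)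
          ≡⟨ cong (λ A → Bx + (across c fromEntry r + A)) (across-across c δ F r) ⟩
        Bx + (across c fromEntry r + across c (across δ F) r)
          ≡⟨ cong (Bx +_) (across-+ c fromEntry (across δ F) r) ⟩
        Bx + across c (λ t → fromEntry t + across δ F t) r
          ≤⟨ ℕP.+-monoʳ-≤ Bx (across-mono c (absorb fromEntry fromEntry≤W) r) ⟩
        Bx + across c F r
          ≤⟨ with-future x r 1≤r ⟩
        mult * r
          ∎
        where
        open ℕP.≤-Reasoning
        c Bx : ℕ
        c = dA x (end j)
        Bx = ball (distance j) (repeat ω j) x r
      ... | right y = begin
        ball (distance (suc j)) ω′ (inr y) r + across (d (inr y) (inr exit)) F r
          ≡⟨ cong₂ (λ B c → B + across c F r) (ball-inr (repeat ω j) ω y r) (d-inr-inr y exit) ⟩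
        across (dU y entry) (ball (distance j) (repeat ω j) (end j)) r + ball DU ω y r + across (dU y exit) F r
          ≤⟨ ℕP.+-monoˡ-≤ _ (ℕP.+-monoˡ-≤ _ (across-mono _ end-ball r)) ⟩
        localTerm y r
          ≤⟨ local y r 1≤r ⟩
        mult * r
          ∎
        where open ℕP.≤-Reasoning

    invariant : LocalBound → ∀ j → Invariant j
    invariant local zero    = invariant-zero local
    invariant local (suc j) = invariant-suc local (invariant local j)

    chain-ball-bound : LocalBound → ∀ j v r → 1 ≤ r → ball (distance j) (repeat ω j) v r ≤ mult * r
    chain-ball-bound local j v r 1≤r = ℕP.≤-trans (ℕP.m≤m+n _ _) (Invariant.with-future (invariant local j) v r 1≤r)

    module _ (diameter : ∀ u v → dU u v ≤ δ) (W+W≤ : W + W ≤ mult * p) where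

      localTerm-step : ∀ y {r} → p ≤ r → localTerm y (r + p) ≡ localTerm y r + (W + W)
      localTerm-step y {r} p≤r = begin
        across (dU y entry) (periodic fromExit) (r + p) + ball DU ω y (r + p) + across (dU y exit) (periodic fromEntry) (r + p)
          ≡⟨ cong₂ _+_ (cong₂ _+_ (across-periodic-step fromExit (near entry))
                                  (trans (full (r + p) (ℕP.m≤n⇒m≤n+o p p≤r)) (sym (full r p≤r))))
                       (across-periodic-step fromEntry (near exit)) ⟩
        (W + L) + B + (W + R)
          ≡⟨ solve 4 (λ W L B R → (W :+ L) :+ B :+ (W :+ R) := L :+ B :+ R :+ (W :+ W)) refl W L B R ⟩
        L + B + R + (W + W)
          ∎
        where
        open ≡-Reasoning
        open +-*-Solver
        L B R : ℕ
        L = across (dU y entry) (periodic fromExit) r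
        B = ball DU ω y r
        R = across (dU y exit) (periodic fromEntry) r
        near : ∀ u → dU y u < r
        near u = ℕP.<-≤-trans (s≤s (diameter y u)) p≤r
        full : ∀ s → p ≤ s → ball DU ω y s ≡ W
        full s p≤s = ball-full DU ω y s (λ u → ℕP.≤-trans (ℕP.m≤n⇒m≤1+n (diameter y u)) p≤s)

      local-bound-from-window : (∀ y r → 1 ≤ r → r < p + p → localTerm y r ≤ mult * r) → LocalBound
      local-bound-from-window window y = <-rec (λ r → 1 ≤ r → localTerm y r ≤ mult * r) bound
        where
        bound : ∀ r → (∀ {s} → s < r → 1 ≤ s → localTerm y s ≤ mult * s) →
                1 ≤ r → localTerm y r ≤ mult * r
        bound r rec 1≤r with r ℕP.<? p + p
        ... | yes r<2p = window y r 1≤r r<2p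
        ... | no r≮2p = subst (λ s → localTerm y s ≤ mult * s) (ℕP.m∸n+n≡m p≤r) (begin
          localTerm y (r ∸ p + p)                 ≡⟨ localTerm-step y p≤r∸p ⟩
          localTerm y (r ∸ p) + (W + W)           ≤⟨ ℕP.+-mono-≤ (rec r∸p<r (ℕP.≤-trans (s≤s z≤n) p≤r∸p))
                                                                 W+W≤ ⟩
          mult * (r ∸ p) + mult * p               ≡⟨ sym (ℕP.*-distribˡ-+ mult (r ∸ p) p) ⟩
          mult * (r ∸ p + p)                      ∎)
          where
          open ℕP.≤-Reasoning
          p≤r∸p : p ≤ r ∸ p
          p≤r∸p = ℕP.m+n≤o⇒m≤o∸n p (ℕP.≮⇒≥ r≮2p)
          p≤r : p ≤ r
          p≤r = ℕP.≤-trans (ℕP.m≤m+n p p) (ℕP.≮⇒≥ r≮2p)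
          r∸p<r : r ∸ p < r
          r∸p<r = ℕP.∸-monoʳ-< (s≤s z≤n) p≤r

-- The unit

neighbours : Vec (List (Fin 36)) 36
neighbours =
  (# 1 ∷ []) ∷
  (# 0 ∷ # 2 ∷ []) ∷
  (# 1 ∷ # 3 ∷ []) ∷
  (# 2 ∷ # 4 ∷ []) ∷
  (# 3 ∷ # 5 ∷ []) ∷
  (# 4 ∷ # 6 ∷ []) ∷
  (# 5 ∷ # 8 ∷ # 9 ∷ []) ∷
  (# 8 ∷ # 9 ∷ # 10 ∷ # 11 ∷ []) ∷
  (# 6 ∷ # 7 ∷ # 9 ∷ # 11 ∷ []) ∷
  (# 6 ∷ # 7 ∷ # 8 ∷ # 10 ∷ []) ∷
  (# 7 ∷ # 9 ∷ # 12 ∷ []) ∷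
  (# 7 ∷ # 8 ∷ []) ∷
  (# 10 ∷ # 13 ∷ []) ∷
  (# 12 ∷ # 14 ∷ []) ∷
  (# 13 ∷ # 15 ∷ []) ∷
  (# 14 ∷ # 16 ∷ []) ∷
  (# 15 ∷ # 17 ∷ []) ∷
  (# 16 ∷ # 18 ∷ []) ∷
  (# 17 ∷ # 20 ∷ # 21 ∷ []) ∷
  (# 20 ∷ # 21 ∷ # 22 ∷ # 23 ∷ []) ∷
  (# 18 ∷ # 19 ∷ # 21 ∷ # 23 ∷ []) ∷
  (# 18 ∷ # 19 ∷ # 20 ∷ # 22 ∷ []) ∷
  (# 19 ∷ # 21 ∷ # 27 ∷ []) ∷
  (# 19 ∷ # 20 ∷ # 24 ∷ []) ∷
  (# 23 ∷ # 25 ∷ []) ∷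
  (# 24 ∷ # 26 ∷ []) ∷
  (# 25 ∷ []) ∷
  (# 22 ∷ # 28 ∷ []) ∷
  (# 27 ∷ # 29 ∷ []) ∷
  (# 28 ∷ # 30 ∷ []) ∷
  (# 29 ∷ # 32 ∷ # 33 ∷ []) ∷
  (# 32 ∷ # 33 ∷ # 34 ∷ # 35 ∷ []) ∷
  (# 30 ∷ # 31 ∷ # 33 ∷ # 35 ∷ []) ∷
  (# 30 ∷ # 31 ∷ # 32 ∷ # 34 ∷ []) ∷
  (# 31 ∷ # 33 ∷ []) ∷
  (# 31 ∷ # 32 ∷ []) ∷
  []

distances : Vec (Vec ℕ 36) 36
distances =
  ( 0 ∷  1 ∷  2 ∷  3 ∷  4 ∷  5 ∷  6 ∷  8 ∷  7 ∷  7 ∷  8 ∷  8 ∷  9 ∷ 10 ∷ 11 ∷ 12 ∷ 13 ∷ 14 ∷ 15 ∷ 17 ∷ 16 ∷ 16 ∷ 17 ∷ 17 ∷ 18 ∷ 19 ∷ 20 ∷ 18 ∷ 19 ∷ 20 ∷ 21 ∷ 23 ∷ 22 ∷ 22 ∷ 23 ∷ 23 ∷ []) ∷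
  ( 1 ∷  0 ∷  1 ∷  2 ∷  3 ∷  4 ∷  5 ∷  7 ∷  6 ∷  6 ∷  7 ∷  7 ∷  8 ∷  9 ∷ 10 ∷ 11 ∷ 12 ∷ 13 ∷ 14 ∷ 16 ∷ 15 ∷ 15 ∷ 16 ∷ 16 ∷ 17 ∷ 18 ∷ 19 ∷ 17 ∷ 18 ∷ 19 ∷ 20 ∷ 22 ∷ 21 ∷ 21 ∷ 22 ∷ 22 ∷ []) ∷
  ( 2 ∷  1 ∷  0 ∷  1 ∷  2 ∷  3 ∷  4 ∷  6 ∷  5 ∷  5 ∷  6 ∷  6 ∷  7 ∷  8 ∷  9 ∷ 10 ∷ 11 ∷ 12 ∷ 13 ∷ 15 ∷ 14 ∷ 14 ∷ 15 ∷ 15 ∷ 16 ∷ 17 ∷ 18 ∷ 16 ∷ 17 ∷ 18 ∷ 19 ∷ 21 ∷ 20 ∷ 20 ∷ 21 ∷ 21 ∷ []) ∷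
  ( 3 ∷  2 ∷  1 ∷  0 ∷  1 ∷  2 ∷  3 ∷  5 ∷  4 ∷  4 ∷  5 ∷  5 ∷  6 ∷  7 ∷  8 ∷  9 ∷ 10 ∷ 11 ∷ 12 ∷ 14 ∷ 13 ∷ 13 ∷ 14 ∷ 14 ∷ 15 ∷ 16 ∷ 17 ∷ 15 ∷ 16 ∷ 17 ∷ 18 ∷ 20 ∷ 19 ∷ 19 ∷ 20 ∷ 20 ∷ []) ∷
  ( 4 ∷  3 ∷  2 ∷  1 ∷  0 ∷  1 ∷  2 ∷  4 ∷  3 ∷  3 ∷  4 ∷  4 ∷  5 ∷  6 ∷  7 ∷  8 ∷  9 ∷ 10 ∷ 11 ∷ 13 ∷ 12 ∷ 12 ∷ 13 ∷ 13 ∷ 14 ∷ 15 ∷ 16 ∷ 14 ∷ 15 ∷ 16 ∷ 17 ∷ 19 ∷ 18 ∷ 18 ∷ 19 ∷ 19 ∷ []) ∷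
  ( 5 ∷  4 ∷  3 ∷  2 ∷  1 ∷  0 ∷  1 ∷  3 ∷  2 ∷  2 ∷  3 ∷  3 ∷  4 ∷  5 ∷  6 ∷  7 ∷  8 ∷  9 ∷ 10 ∷ 12 ∷ 11 ∷ 11 ∷ 12 ∷ 12 ∷ 13 ∷ 14 ∷ 15 ∷ 13 ∷ 14 ∷ 15 ∷ 16 ∷ 18 ∷ 17 ∷ 17 ∷ 18 ∷ 18 ∷ []) ∷
  ( 6 ∷  5 ∷  4 ∷  3 ∷  2 ∷  1 ∷  0 ∷  2 ∷  1 ∷  1 ∷  2 ∷  2 ∷  3 ∷  4 ∷  5 ∷  6 ∷  7 ∷  8 ∷  9 ∷ 11 ∷ 10 ∷ 10 ∷ 11 ∷ 11 ∷ 12 ∷ 13 ∷ 14 ∷ 12 ∷ 13 ∷ 14 ∷ 15 ∷ 17 ∷ 16 ∷ 16 ∷ 17 ∷ 17 ∷ []) ∷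
  ( 8 ∷  7 ∷  6 ∷  5 ∷  4 ∷  3 ∷  2 ∷  0 ∷  1 ∷  1 ∷  1 ∷  1 ∷  2 ∷  3 ∷  4 ∷  5 ∷  6 ∷  7 ∷  8 ∷ 10 ∷  9 ∷  9 ∷ 10 ∷ 10 ∷ 11 ∷ 12 ∷ 13 ∷ 11 ∷ 12 ∷ 13 ∷ 14 ∷ 16 ∷ 15 ∷ 15 ∷ 16 ∷ 16 ∷ []) ∷
  ( 7 ∷  6 ∷  5 ∷  4 ∷  3 ∷  2 ∷  1 ∷  1 ∷  0 ∷  1 ∷  2 ∷  1 ∷  3 ∷  4 ∷  5 ∷  6 ∷  7 ∷  8 ∷  9 ∷ 11 ∷ 10 ∷ 10 ∷ 11 ∷ 11 ∷ 12 ∷ 13 ∷ 14 ∷ 12 ∷ 13 ∷ 14 ∷ 15 ∷ 17 ∷ 16 ∷ 16 ∷ 17 ∷ 17 ∷ []) ∷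
  ( 7 ∷  6 ∷  5 ∷  4 ∷  3 ∷  2 ∷  1 ∷  1 ∷  1 ∷  0 ∷  1 ∷  2 ∷  2 ∷  3 ∷  4 ∷  5 ∷  6 ∷  7 ∷  8 ∷ 10 ∷  9 ∷  9 ∷ 10 ∷ 10 ∷ 11 ∷ 12 ∷ 13 ∷ 11 ∷ 12 ∷ 13 ∷ 14 ∷ 16 ∷ 15 ∷ 15 ∷ 16 ∷ 16 ∷ []) ∷
  ( 8 ∷  7 ∷  6 ∷  5 ∷  4 ∷  3 ∷  2 ∷  1 ∷  2 ∷  1 ∷  0 ∷  2 ∷  1 ∷  2 ∷  3 ∷  4 ∷  5 ∷  6 ∷  7 ∷  9 ∷  8 ∷  8 ∷  9 ∷  9 ∷ 10 ∷ 11 ∷ 12 ∷ 10 ∷ 11 ∷ 12 ∷ 13 ∷ 15 ∷ 14 ∷ 14 ∷ 15 ∷ 15 ∷ []) ∷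
  ( 8 ∷  7 ∷  6 ∷  5 ∷  4 ∷  3 ∷  2 ∷  1 ∷  1 ∷  2 ∷  2 ∷  0 ∷  3 ∷  4 ∷  5 ∷  6 ∷  7 ∷  8 ∷  9 ∷ 11 ∷ 10 ∷ 10 ∷ 11 ∷ 11 ∷ 12 ∷ 13 ∷ 14 ∷ 12 ∷ 13 ∷ 14 ∷ 15 ∷ 17 ∷ 16 ∷ 16 ∷ 17 ∷ 17 ∷ []) ∷
  ( 9 ∷  8 ∷  7 ∷  6 ∷  5 ∷  4 ∷  3 ∷  2 ∷  3 ∷  2 ∷  1 ∷  3 ∷  0 ∷  1 ∷  2 ∷  3 ∷  4 ∷  5 ∷  6 ∷  8 ∷  7 ∷  7 ∷  8 ∷  8 ∷  9 ∷ 10 ∷ 11 ∷  9 ∷ 10 ∷ 11 ∷ 12 ∷ 14 ∷ 13 ∷ 13 ∷ 14 ∷ 14 ∷ []) ∷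
  (10 ∷  9 ∷  8 ∷  7 ∷  6 ∷  5 ∷  4 ∷  3 ∷  4 ∷  3 ∷  2 ∷  4 ∷  1 ∷  0 ∷  1 ∷  2 ∷  3 ∷  4 ∷  5 ∷  7 ∷  6 ∷  6 ∷  7 ∷  7 ∷  8 ∷  9 ∷ 10 ∷  8 ∷  9 ∷ 10 ∷ 11 ∷ 13 ∷ 12 ∷ 12 ∷ 13 ∷ 13 ∷ []) ∷
  (11 ∷ 10 ∷  9 ∷  8 ∷  7 ∷  6 ∷  5 ∷  4 ∷  5 ∷  4 ∷  3 ∷  5 ∷  2 ∷  1 ∷  0 ∷  1 ∷  2 ∷  3 ∷  4 ∷  6 ∷  5 ∷  5 ∷  6 ∷  6 ∷  7 ∷  8 ∷  9 ∷  7 ∷  8 ∷  9 ∷ 10 ∷ 12 ∷ 11 ∷ 11 ∷ 12 ∷ 12 ∷ []) ∷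
  (12 ∷ 11 ∷ 10 ∷  9 ∷  8 ∷  7 ∷  6 ∷  5 ∷  6 ∷  5 ∷  4 ∷  6 ∷  3 ∷  2 ∷  1 ∷  0 ∷  1 ∷  2 ∷  3 ∷  5 ∷  4 ∷  4 ∷  5 ∷  5 ∷  6 ∷  7 ∷  8 ∷  6 ∷  7 ∷  8 ∷  9 ∷ 11 ∷ 10 ∷ 10 ∷ 11 ∷ 11 ∷ []) ∷
  (13 ∷ 12 ∷ 11 ∷ 10 ∷  9 ∷  8 ∷  7 ∷  6 ∷  7 ∷  6 ∷  5 ∷  7 ∷  4 ∷  3 ∷  2 ∷  1 ∷  0 ∷  1 ∷  2 ∷  4 ∷  3 ∷  3 ∷  4 ∷  4 ∷  5 ∷  6 ∷  7 ∷  5 ∷  6 ∷  7 ∷  8 ∷ 10 ∷  9 ∷  9 ∷ 10 ∷ 10 ∷ []) ∷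
  (14 ∷ 13 ∷ 12 ∷ 11 ∷ 10 ∷  9 ∷  8 ∷  7 ∷  8 ∷  7 ∷  6 ∷  8 ∷  5 ∷  4 ∷  3 ∷  2 ∷  1 ∷  0 ∷  1 ∷  3 ∷  2 ∷  2 ∷  3 ∷  3 ∷  4 ∷  5 ∷  6 ∷  4 ∷  5 ∷  6 ∷  7 ∷  9 ∷  8 ∷  8 ∷  9 ∷  9 ∷ []) ∷
  (15 ∷ 14 ∷ 13 ∷ 12 ∷ 11 ∷ 10 ∷  9 ∷  8 ∷  9 ∷  8 ∷  7 ∷  9 ∷  6 ∷  5 ∷  4 ∷  3 ∷  2 ∷  1 ∷  0 ∷  2 ∷  1 ∷  1 ∷  2 ∷  2 ∷  3 ∷  4 ∷  5 ∷  3 ∷  4 ∷  5 ∷  6 ∷  8 ∷  7 ∷  7 ∷  8 ∷  8 ∷ []) ∷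
  (17 ∷ 16 ∷ 15 ∷ 14 ∷ 13 ∷ 12 ∷ 11 ∷ 10 ∷ 11 ∷ 10 ∷  9 ∷ 11 ∷  8 ∷  7 ∷  6 ∷  5 ∷  4 ∷  3 ∷  2 ∷  0 ∷  1 ∷  1 ∷  1 ∷  1 ∷  2 ∷  3 ∷  4 ∷  2 ∷  3 ∷  4 ∷  5 ∷  7 ∷  6 ∷  6 ∷  7 ∷  7 ∷ []) ∷
  (16 ∷ 15 ∷ 14 ∷ 13 ∷ 12 ∷ 11 ∷ 10 ∷  9 ∷ 10 ∷  9 ∷  8 ∷ 10 ∷  7 ∷  6 ∷  5 ∷  4 ∷  3 ∷  2 ∷  1 ∷  1 ∷  0 ∷  1 ∷  2 ∷  1 ∷  2 ∷  3 ∷  4 ∷  3 ∷  4 ∷  5 ∷  6 ∷  8 ∷  7 ∷  7 ∷  8 ∷  8 ∷ []) ∷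
  (16 ∷ 15 ∷ 14 ∷ 13 ∷ 12 ∷ 11 ∷ 10 ∷  9 ∷ 10 ∷  9 ∷  8 ∷ 10 ∷  7 ∷  6 ∷  5 ∷  4 ∷  3 ∷  2 ∷  1 ∷  1 ∷  1 ∷  0 ∷  1 ∷  2 ∷  3 ∷  4 ∷  5 ∷  2 ∷  3 ∷  4 ∷  5 ∷  7 ∷  6 ∷  6 ∷  7 ∷  7 ∷ []) ∷
  (17 ∷ 16 ∷ 15 ∷ 14 ∷ 13 ∷ 12 ∷ 11 ∷ 10 ∷ 11 ∷ 10 ∷  9 ∷ 11 ∷  8 ∷  7 ∷  6 ∷  5 ∷  4 ∷  3 ∷  2 ∷  1 ∷  2 ∷  1 ∷  0 ∷  2 ∷  3 ∷  4 ∷  5 ∷  1 ∷  2 ∷  3 ∷  4 ∷  6 ∷  5 ∷  5 ∷  6 ∷  6 ∷ []) ∷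
  (17 ∷ 16 ∷ 15 ∷ 14 ∷ 13 ∷ 12 ∷ 11 ∷ 10 ∷ 11 ∷ 10 ∷  9 ∷ 11 ∷  8 ∷  7 ∷  6 ∷  5 ∷  4 ∷  3 ∷  2 ∷  1 ∷  1 ∷  2 ∷  2 ∷  0 ∷  1 ∷  2 ∷  3 ∷  3 ∷  4 ∷  5 ∷  6 ∷  8 ∷  7 ∷  7 ∷  8 ∷  8 ∷ []) ∷
  (18 ∷ 17 ∷ 16 ∷ 15 ∷ 14 ∷ 13 ∷ 12 ∷ 11 ∷ 12 ∷ 11 ∷ 10 ∷ 12 ∷  9 ∷  8 ∷  7 ∷  6 ∷  5 ∷  4 ∷  3 ∷  2 ∷  2 ∷  3 ∷  3 ∷  1 ∷  0 ∷  1 ∷  2 ∷  4 ∷  5 ∷  6 ∷  7 ∷  9 ∷  8 ∷  8 ∷  9 ∷  9 ∷ []) ∷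
  (19 ∷ 18 ∷ 17 ∷ 16 ∷ 15 ∷ 14 ∷ 13 ∷ 12 ∷ 13 ∷ 12 ∷ 11 ∷ 13 ∷ 10 ∷  9 ∷  8 ∷  7 ∷  6 ∷  5 ∷  4 ∷  3 ∷  3 ∷  4 ∷  4 ∷  2 ∷  1 ∷  0 ∷  1 ∷  5 ∷  6 ∷  7 ∷  8 ∷ 10 ∷  9 ∷  9 ∷ 10 ∷ 10 ∷ []) ∷
  (20 ∷ 19 ∷ 18 ∷ 17 ∷ 16 ∷ 15 ∷ 14 ∷ 13 ∷ 14 ∷ 13 ∷ 12 ∷ 14 ∷ 11 ∷ 10 ∷  9 ∷  8 ∷  7 ∷  6 ∷  5 ∷  4 ∷  4 ∷  5 ∷  5 ∷  3 ∷  2 ∷  1 ∷  0 ∷  6 ∷  7 ∷  8 ∷  9 ∷ 11 ∷ 10 ∷ 10 ∷ 11 ∷ 11 ∷ []) ∷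
  (18 ∷ 17 ∷ 16 ∷ 15 ∷ 14 ∷ 13 ∷ 12 ∷ 11 ∷ 12 ∷ 11 ∷ 10 ∷ 12 ∷  9 ∷  8 ∷  7 ∷  6 ∷  5 ∷  4 ∷  3 ∷  2 ∷  3 ∷  2 ∷  1 ∷  3 ∷  4 ∷  5 ∷  6 ∷  0 ∷  1 ∷  2 ∷  3 ∷  5 ∷  4 ∷  4 ∷  5 ∷  5 ∷ []) ∷
  (19 ∷ 18 ∷ 17 ∷ 16 ∷ 15 ∷ 14 ∷ 13 ∷ 12 ∷ 13 ∷ 12 ∷ 11 ∷ 13 ∷ 10 ∷  9 ∷  8 ∷  7 ∷  6 ∷  5 ∷  4 ∷  3 ∷  4 ∷  3 ∷  2 ∷  4 ∷  5 ∷  6 ∷  7 ∷  1 ∷  0 ∷  1 ∷  2 ∷  4 ∷  3 ∷  3 ∷  4 ∷  4 ∷ []) ∷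
  (20 ∷ 19 ∷ 18 ∷ 17 ∷ 16 ∷ 15 ∷ 14 ∷ 13 ∷ 14 ∷ 13 ∷ 12 ∷ 14 ∷ 11 ∷ 10 ∷  9 ∷  8 ∷  7 ∷  6 ∷  5 ∷  4 ∷  5 ∷  4 ∷  3 ∷  5 ∷  6 ∷  7 ∷  8 ∷  2 ∷  1 ∷  0 ∷  1 ∷  3 ∷  2 ∷  2 ∷  3 ∷  3 ∷ []) ∷
  (21 ∷ 20 ∷ 19 ∷ 18 ∷ 17 ∷ 16 ∷ 15 ∷ 14 ∷ 15 ∷ 14 ∷ 13 ∷ 15 ∷ 12 ∷ 11 ∷ 10 ∷  9 ∷  8 ∷  7 ∷  6 ∷  5 ∷  6 ∷  5 ∷  4 ∷  6 ∷  7 ∷  8 ∷  9 ∷  3 ∷  2 ∷  1 ∷  0 ∷  2 ∷  1 ∷  1 ∷  2 ∷  2 ∷ []) ∷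
  (23 ∷ 22 ∷ 21 ∷ 20 ∷ 19 ∷ 18 ∷ 17 ∷ 16 ∷ 17 ∷ 16 ∷ 15 ∷ 17 ∷ 14 ∷ 13 ∷ 12 ∷ 11 ∷ 10 ∷  9 ∷  8 ∷  7 ∷  8 ∷  7 ∷  6 ∷  8 ∷  9 ∷ 10 ∷ 11 ∷  5 ∷  4 ∷  3 ∷  2 ∷  0 ∷  1 ∷  1 ∷  1 ∷  1 ∷ []) ∷
  (22 ∷ 21 ∷ 20 ∷ 19 ∷ 18 ∷ 17 ∷ 16 ∷ 15 ∷ 16 ∷ 15 ∷ 14 ∷ 16 ∷ 13 ∷ 12 ∷ 11 ∷ 10 ∷  9 ∷  8 ∷  7 ∷  6 ∷  7 ∷  6 ∷  5 ∷  7 ∷  8 ∷  9 ∷ 10 ∷  4 ∷  3 ∷  2 ∷  1 ∷  1 ∷  0 ∷  1 ∷  2 ∷  1 ∷ []) ∷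
  (22 ∷ 21 ∷ 20 ∷ 19 ∷ 18 ∷ 17 ∷ 16 ∷ 15 ∷ 16 ∷ 15 ∷ 14 ∷ 16 ∷ 13 ∷ 12 ∷ 11 ∷ 10 ∷  9 ∷  8 ∷  7 ∷  6 ∷  7 ∷  6 ∷  5 ∷  7 ∷  8 ∷  9 ∷ 10 ∷  4 ∷  3 ∷  2 ∷  1 ∷  1 ∷  1 ∷  0 ∷  1 ∷  2 ∷ []) ∷
  (23 ∷ 22 ∷ 21 ∷ 20 ∷ 19 ∷ 18 ∷ 17 ∷ 16 ∷ 17 ∷ 16 ∷ 15 ∷ 17 ∷ 14 ∷ 13 ∷ 12 ∷ 11 ∷ 10 ∷  9 ∷  8 ∷  7 ∷  8 ∷  7 ∷  6 ∷  8 ∷  9 ∷ 10 ∷ 11 ∷  5 ∷  4 ∷  3 ∷  2 ∷  1 ∷  2 ∷  1 ∷  0 ∷  2 ∷ []) ∷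
  (23 ∷ 22 ∷ 21 ∷ 20 ∷ 19 ∷ 18 ∷ 17 ∷ 16 ∷ 17 ∷ 16 ∷ 15 ∷ 17 ∷ 14 ∷ 13 ∷ 12 ∷ 11 ∷ 10 ∷  9 ∷  8 ∷  7 ∷  8 ∷  7 ∷  6 ∷  8 ∷  9 ∷ 10 ∷ 11 ∷  5 ∷  4 ∷  3 ∷  2 ∷  1 ∷  1 ∷  2 ∷  2 ∷  0 ∷ []) ∷
  []

ranks : Vec ℕ 36
ranks = 35 ∷ 34 ∷ 33 ∷ 32 ∷ 31 ∷ 30 ∷ 29 ∷ 26 ∷ 28 ∷ 27 ∷ 25 ∷ 24 ∷ 23 ∷ 22 ∷ 21 ∷ 20 ∷ 19 ∷ 18 ∷ 17 ∷ 14 ∷ 16 ∷ 15 ∷ 13 ∷ 12 ∷ 11 ∷ 10 ∷ 9 ∷ 8 ∷ 7 ∷ 6 ∷ 5 ∷ 2 ∷ 4 ∷ 3 ∷ 1 ∷ 0 ∷ []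

broadcasts : Vec ℕ 36
broadcasts = 0 ∷ 1 ∷ 0 ∷ 0 ∷ 1 ∷ 0 ∷ 0 ∷ 0 ∷ 1 ∷ 0 ∷ 0 ∷ 0 ∷ 1 ∷ 0 ∷ 0 ∷ 1 ∷ 0 ∷ 0 ∷ 0 ∷ 0 ∷ 0 ∷ 2 ∷ 0 ∷ 0 ∷ 0 ∷ 1 ∷ 0 ∷ 0 ∷ 0 ∷ 1 ∷ 0 ∷ 1 ∷ 0 ∷ 0 ∷ 0 ∷ 0 ∷ []

adjU : Fin 36 → Fin 36 → Bool
adjU u v = does (v ∈? lookup neighbours u)

dU : Fin 36 → Fin 36 → ℕ
dU u v = lookup (lookup distances u) v

rankU : Fin 36 → ℕ
rankU = lookup ranks

-- Facts checked by evaluation are opaque, so that they are never evaluated again where used.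
opaque
  adjU-sym : ∀ u v → adjU u v ≡ adjU v u
  adjU-sym = from-yes (all? λ u → all? λ v → adjU u v BoolP.≟ adjU v u)

  adjU-irrefl : ∀ u → adjU u u ≡ false
  adjU-irrefl = from-yes (all? λ u → adjU u u BoolP.≟ false)

unit : Graph
unit = record { n = 36 ; adj = adjU ; sym = adjU-sym ; irrefl = adjU-irrefl }

neighbour-edge : ∀ u {v} → v ∈ lookup neighbours u → Edge unit u v
neighbour-edge u {v} v∈ = dec-true (v ∈? lookup neighbours u) v∈

edge-neighbour : ∀ u v → Edge unit u v → v ∈ lookup neighbours u
edge-neighbour u v e = T-does⁻ (v ∈? lookup neighbours u) (from BoolP.T-≡ e)

opaque
  dU-self : ∀ u → dU u u ≡ 0
  dU-self = from-yes (all? λ u → dU u u ℕ.≟ 0)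

  dU-next-hop : ∀ u v → u ≡ v ⊎ Any (λ w → suc (dU w v) ≡ dU u v) (lookup neighbours u)
  dU-next-hop = from-yes (all? λ u → all? λ v →
    (u Fin.≟ v) ⊎-dec Any.any? (λ w → suc (dU w v) ℕ.≟ dU u v) (lookup neighbours u))

  dU-edge : ∀ u z → All (λ z′ → dU u z′ ≤ suc (dU u z)) (lookup neighbours z)
  dU-edge = from-yes (all? λ u → all? λ z → All.all? (λ z′ → dU u z′ ℕ.≤? suc (dU u z)) (lookup neighbours z))

reach-dU : ∀ m u v → dU u v ≡ m → Reach unit m u v
reach-dU m u v d≡m with dU-next-hop u v
... | inj₁ refl = subst (λ k → Reach unit k u u) (trans (sym (dU-self u)) d≡m) (reach-refl u)
... | inj₂ hop with find hop | m
...   | w , w∈ , 1+dw | zero  = ⊥-elim (ℕP.1+n≢0 (trans 1+dw d≡m))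
...   | w , w∈ , 1+dw | suc m = reach-step (neighbour-edge u w∈) (reach-dU m w v (ℕP.suc-injective (trans 1+dw d≡m)))

unitDistance : Distance unit
unitDistance = record
  { d         = dU
  ; reach-d   = λ u v → reach-dU (dU u v) u v refl
  ; d-minimal = λ {r} {u} {v} h → subst (dU u v ≤_) (trans (cong (r +_) (dU-self u)) (ℕP.+-identityʳ r))
                  (reach-lipschitz (dU u) (λ {z} {z′} e → All.lookup (dU-edge u z) (edge-neighbour z z′ e)) h)
  }

opaque
  rankU-injective : ∀ u v → rankU u ≡ rankU v → u ≡ v
  rankU-injective = from-yes (all? λ u → all? λ v → (rankU u ℕ.≟ rankU v) →-dec (u Fin.≟ v))

  later-neighbours-adjacent :
    ∀ v → All (λ u → All (λ w → rankU v < rankU u → rankU v < rankU w → u ≢ w → Edge unit u w)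
                         (lookup neighbours v))
              (lookup neighbours v)
  later-neighbours-adjacent = from-yes (all? λ v → All.all? (λ u → All.all? (λ w →
    (rankU v ℕ.<? rankU u) →-dec (rankU v ℕ.<? rankU w) →-dec ¬? (u Fin.≟ w) →-dec (adjU u w BoolP.≟ true))
    (lookup neighbours v)) (lookup neighbours v))

unitPEO : PerfectEliminationOrder unit
unitPEO = record
  { rank           = rankU
  ; rank-injective = rankU-injective _ _
  ; simplicial     = λ {v} {u} {w} e₁ e₂ →
                       All.lookup (All.lookup (later-neighbours-adjacent v) (edge-neighbour v u e₁)) (edge-neighbour v w e₂)
  }

entry exit : Fin 36
entry = # 0
exit  = # 34

opaque
  entry-last : ∀ y → rankU y ≤ rankU entry
  entry-last = from-yes (all? λ y → rankU y ℕ.≤? rankU entry)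

open Chain unit unitDistance entry exit

opaque
  unit-diameter : ∀ u v → dU u v ≤ δ
  unit-diameter = from-yes (all? λ u → all? λ v → dU u v ℕ.≤? δ)

-- A multipacking of U, and the support of a fractional multipacking with weight 1/2 per vertex.
packingIndicator halfIndicator : Vec ℕ 36
packingIndicator = 1 ∷ 0 ∷ 0 ∷ 1 ∷ 0 ∷ 0 ∷ 1 ∷ 0 ∷ 0 ∷ 0 ∷ 0 ∷ 0 ∷ 1 ∷ 0 ∷ 0 ∷ 1 ∷ 0 ∷ 0 ∷ 1 ∷ 0 ∷ 0 ∷ 0 ∷ 0 ∷ 0 ∷ 1 ∷ 0 ∷ 0 ∷ 0 ∷ 1 ∷ 0 ∷ 0 ∷ 0 ∷ 1 ∷ 0 ∷ 0 ∷ 0 ∷ []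
halfIndicator    = 1 ∷ 1 ∷ 0 ∷ 1 ∷ 1 ∷ 0 ∷ 1 ∷ 0 ∷ 0 ∷ 0 ∷ 1 ∷ 1 ∷ 1 ∷ 0 ∷ 1 ∷ 1 ∷ 0 ∷ 1 ∷ 1 ∷ 0 ∷ 0 ∷ 0 ∷ 1 ∷ 1 ∷ 0 ∷ 1 ∷ 1 ∷ 0 ∷ 1 ∷ 1 ∷ 0 ∷ 1 ∷ 1 ∷ 0 ∷ 0 ∷ 0 ∷ []

rowBall : ∀ {m} → Vec ℕ m → Vec ℕ m → ℕ → ℕ
rowBall []       []       t = 0
rowBall (d ∷ ds) (w ∷ ws) t = (if d ≤ᵇ t then w else 0) + rowBall ds ws t

sum≡rowBall : ∀ {m} (ds ws : Vec ℕ m) t →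
              sum (λ i → if lookup ds i ≤ᵇ t then lookup ws i else 0) ≡ rowBall ds ws t
sum≡rowBall []       []       t = refl
sum≡rowBall (d ∷ ds) (w ∷ ws) t = cong ((if d ≤ᵇ t then w else 0) +_) (sum≡rowBall ds ws t)

-- localTerm evaluated row by row of the distance table: the generic definition is far too slow to
-- evaluate for all 36 · 48 cases.
unitLocalTerm : Vec ℕ 36 → ℕ → Fin 36 → ℕ → ℕ
unitLocalTerm ws W y r =
  across (dU y entry) (λ t → W * (t ÷ p) + rowBall (lookup distances exit) ws (t % p)) r
  + rowBall (lookup distances y) ws r
  + across (dU y exit) (λ t → W * (t ÷ p) + rowBall (lookup distances entry) ws (t % p)) r

module PackingBalls = BallBound (lookup packingIndicator) 1
module HalfBalls    = BallBound (lookup halfIndicator) 2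

opaque
  packing-window : ∀ y (r : Fin (p + p)) → 1 ≤ toℕ r → unitLocalTerm packingIndicator 9 y (toℕ r) ≤ 1 * toℕ r
  packing-window = from-yes (all? λ y → all? λ (r : Fin (p + p)) →
    (1 ℕ.≤? toℕ r) →-dec (unitLocalTerm packingIndicator 9 y (toℕ r) ℕ.≤? 1 * toℕ r))

  half-window : ∀ y (r : Fin (p + p)) → 1 ≤ toℕ r → unitLocalTerm halfIndicator 20 y (toℕ r) ≤ 2 * toℕ r
  half-window = from-yes (all? λ y → all? λ (r : Fin (p + p)) →
    (1 ℕ.≤? toℕ r) →-dec (unitLocalTerm halfIndicator 20 y (toℕ r) ℕ.≤? 2 * toℕ r))

packing-local : PackingBalls.LocalBound
packing-local = PackingBalls.local-bound-from-window unit-diameter (ℕP.≤ᵇ⇒≤ 18 24 _) λ y r 1≤r r<2p →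
  subst (_≤ 1 * r) (sym (PackingBalls.localTerm-via _ (λ x → sum≡rowBall (lookup distances x) packingIndicator) refl y r))
    (below-from-Fin {P = λ r → 1 ≤ r → unitLocalTerm packingIndicator 9 y r ≤ 1 * r} (packing-window y) r r<2p 1≤r)

half-local : HalfBalls.LocalBound
half-local = HalfBalls.local-bound-from-window unit-diameter (ℕP.≤ᵇ⇒≤ 40 48 _) λ y r 1≤r r<2p →
  subst (_≤ 2 * r) (sym (HalfBalls.localTerm-via _ (λ x → sum≡rowBall (lookup distances x) halfIndicator) refl y r))
    (below-from-Fin {P = λ r → 1 ≤ r → unitLocalTerm halfIndicator 20 y r ≤ 2 * r} (half-window y) r r<2p 1≤r)

inPacking : Fin 36 → Bool
inPacking u = 0 <ᵇ lookup packingIndicator u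

part₁ part₂ part₃ : Fin 36 → Bool
part₁ u = toℕ u <ᵇ 12
part₂ u = (12 ≤ᵇ toℕ u) ∧ (toℕ u <ᵇ 27)
part₃ u = 27 ≤ᵇ toℕ u

cover₁ : Vec (Fin 36) 7
cover₁ = # 1 ∷ # 1 ∷ # 7 ∷ # 9 ∷ # 8 ∷ # 4 ∷ # 4 ∷ []

cover₂ : Vec (Fin 36) 9
cover₂ = # 13 ∷ # 13 ∷ # 25 ∷ # 25 ∷ # 19 ∷ # 21 ∷ # 16 ∷ # 16 ∷ # 20 ∷ []

cover₃ : Vec (Fin 36) 5
cover₃ = # 28 ∷ # 28 ∷ # 31 ∷ # 33 ∷ # 32 ∷ []

Covers-twice : ∀ {k} → (Fin 36 → Bool) → Vec (Fin 36) k → Set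
Covers-twice S cover = ∀ u → T (S u) → 2 ≤ sum (λ i → 𝟙 (dU (lookup cover i) u ≤ᵇ 1))

covers-twice? : ∀ {k} S (cover : Vec (Fin 36) k) → Dec (Covers-twice S cover)
covers-twice? S cover = all? λ u → T? (S u) →-dec (2 ℕ.≤? sum (λ i → 𝟙 (dU (lookup cover i) u ≤ᵇ 1)))

opaque
  𝟙-inPacking : ∀ u → 𝟙 (inPacking u) ≡ lookup packingIndicator u
  𝟙-inPacking = from-yes (all? λ u → 𝟙 (inPacking u) ℕ.≟ lookup packingIndicator u)

  parts-partition : ∀ u → 𝟙 (part₁ u) + 𝟙 (part₂ u) + 𝟙 (part₃ u) ≡ 1
  parts-partition = from-yes (all? λ u → 𝟙 (part₁ u) + 𝟙 (part₂ u) + 𝟙 (part₃ u) ℕ.≟ 1)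

  covered₁ : Covers-twice part₁ cover₁
  covered₁ = from-yes (covers-twice? part₁ cover₁)

  covered₂ : Covers-twice part₂ cover₂
  covered₂ = from-yes (covers-twice? part₂ cover₂)

  covered₃ : Covers-twice part₃ cover₃
  covered₃ = from-yes (covers-twice? part₃ cover₃)

unit-multipacking-bound : ∀ M → IsMultipacking unit M → card unit M ≤ 9
unit-multipacking-bound M M-mp = begin
  card unit M
    ≡⟨ card≡sum unit M ⟩
  sum (𝟙 ∘ M)
    ≡⟨ sum-cong-≗ by-part ⟩
  sum (λ u → in-part part₁ u + in-part part₂ u + in-part part₃ u)
    ≡⟨ ∑-distrib-+ (λ u → in-part part₁ u + in-part part₂ u) (in-part part₃) ⟩
  sum (λ u → in-part part₁ u + in-part part₂ u) + sum (in-part part₃)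
    ≡⟨ cong (_+ sum (in-part part₃)) (∑-distrib-+ (in-part part₁) (in-part part₂)) ⟩
  sum (in-part part₁) + sum (in-part part₂) + sum (in-part part₃)
    ≤⟨ ℕP.+-mono-≤ (ℕP.+-mono-≤ (part-bound part₁ 3 cover₁ covered₁) (part-bound part₂ 4 cover₂ covered₂))
                   (part-bound part₃ 2 cover₃ covered₃) ⟩
  3 + 4 + 2
    ∎
  where
  open ℕP.≤-Reasoning
  in-part : (Fin 36 → Bool) → Fin 36 → ℕ
  in-part S u = 𝟙 (M u ∧ S u)
  by-part : ∀ u → 𝟙 (M u) ≡ in-part part₁ u + in-part part₂ u + in-part part₃ u
  by-part u with M u
  ... | false = refl
  ... | true  = sym (parts-partition u)
  packing : ∀ c → ball unitDistance (𝟙 ∘ M) c 1 ≤ 1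
  packing c = subst (_≤ 1) (card-ball unitDistance M c 1) (M-mp c 1 ℕP.≤-refl)
  part-bound : ∀ S b (cover : Vec (Fin 36) (suc (2 * b))) → Covers-twice S cover → sum (in-part S) ≤ b
  part-bound S b cover covered = 2*m≤1+2*n⇒m≤n (double-cover unitDistance {M} packing S (lookup cover) covered)

broadcastU : Fin 36 → ℕ
broadcastU = lookup broadcasts

opaque
  unit-dominated : ∀ u → ∃ λ v → 0 < broadcastU v × dU u v ≤ broadcastU v
  unit-dominated = from-yes (all? λ u → any? λ v → (0 ℕ.<? broadcastU v) ×-dec (dU u v ℕ.≤? broadcastU v))

  broadcastU≤2 : ∀ u → broadcastU u ≤ 2
  broadcastU≤2 = from-yes (all? λ u → broadcastU u ℕ.≤? 2)

unit-dominating : Dominating unit broadcastU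
unit-dominating u = let v , 0<f , d≤f = unit-dominated u in
  v , 0<f , Reach.dist≤ (from (Distance.reach⇔d≤ unitDistance) d≤f)

packingChain : ∀ j → Vertex (chain j) → Bool
packingChain = repeat inPacking

packingChain-indicator : ∀ j → 𝟙 ∘ packingChain j ≗ repeat (lookup packingIndicator) j
packingChain-indicator j v = trans (repeat-map 𝟙 inPacking j v) (repeat-cong 𝟙-inPacking j v)

packingChain-multipacking : ∀ j → IsMultipacking (chain j) (packingChain j)
packingChain-multipacking j = multipacking-from-balls (distance j) (packingChain j) λ v r 1≤r → begin
  ball (distance j) (𝟙 ∘ packingChain j) v r
    ≡⟨ ball-cong (distance j) (packingChain-indicator j) v r ⟩
  ball (distance j) (repeat (lookup packingIndicator) j) v r
    ≤⟨ PackingBalls.chain-ball-bound packing-local j v r 1≤r ⟩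
  1 * r
    ≡⟨ ℕP.*-identityˡ r ⟩
  r
    ∎
  where open ℕP.≤-Reasoning

packingChain-size : ∀ j → card (chain j) (packingChain j) ≡ 9 * suc j
packingChain-size j = begin
  card (chain j) (packingChain j)                 ≡⟨ card≡sum (chain j) (packingChain j) ⟩
  sum (𝟙 ∘ packingChain j)                        ≡⟨ sum-cong-≗ (packingChain-indicator j) ⟩
  sum (repeat (lookup packingIndicator) j)        ≡⟨ sum-repeat (lookup packingIndicator) j ⟩
  suc j * 9                                       ≡⟨ ℕP.*-comm (suc j) 9 ⟩
  9 * suc j                                       ∎
  where open ≡-Reasoning

halfChain : ∀ j → Vertex (chain j) → ℚ
halfChain j = half ∘ repeat (lookup halfIndicator) j

halfChain-fractional : ∀ j → IsFracMultipacking (chain j) (halfChain j)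
halfChain-fractional j = fractional-from-balls (distance j) _ (HalfBalls.chain-ball-bound half-local j)

halfChain-weight : ∀ j → weight (chain j) (halfChain j) ≡ ℕtoℚ (10 * suc j)
halfChain-weight j = begin
  weight (chain j) (halfChain j)                  ≡⟨ weight≡sum (chain j) (halfChain j) ⟩
  ∑ℚ.sum (halfChain j)                            ≡⟨ sum-half (repeat (lookup halfIndicator) j) ⟩
  half (sum (repeat (lookup halfIndicator) j))    ≡⟨ cong half (sum-repeat (lookup halfIndicator) j) ⟩
  half (suc j * 20)                               ≡⟨ cong half (solve 1 (λ k → k :* con 20 := con 2 :* (con 10 :* k))
                                                                      refl (suc j)) ⟩
  half (2 * (10 * suc j))                         ≡⟨ half-double (10 * suc j) ⟩
  ℕtoℚ (10 * suc j)                               ∎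
  where
  open ≡-Reasoning
  open +-*-Solver

broadcastChain : ∀ j → Vertex (chain j) → ℕ
broadcastChain = repeat broadcastU

broadcastChain-broadcast : ∀ j → IsBroadcast (chain j) (broadcastChain j)
broadcastChain-broadcast j v with repeat-image broadcastU j v | far-pair j
... | u , f≡ | x , y , d≡ = ≤Diam-from-distance (distance j) x y (begin
  broadcastChain j v   ≡⟨ f≡ ⟩
  broadcastU u         ≤⟨ broadcastU≤2 u ⟩
  2                    ≤⟨ ℕP.≤ᵇ⇒≤ 2 23 _ ⟩
  δ                    ≡⟨ d≡ ⟨
  Distance.d (distance j) x y ∎)
  where open ℕP.≤-Reasoning

broadcastChain-dominating : ∀ j → Dominating (chain j) (broadcastChain j)
broadcastChain-dominating = dominating-repeat unit-dominating

broadcastChain-cost : ∀ j → cost (chain j) (broadcastChain j) ≡ 10 * suc j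
broadcastChain-cost j = trans (cost≡sum (chain j) (broadcastChain j))
                              (trans (sum-repeat broadcastU j) (ℕP.*-comm (suc j) 10))

-- The notation of the statement, imported only here because +_ and _/_ clash with ℕ notation.
open import Data.Integer using (+_)
open import Data.Rational using (_/_) renaming (_*_ to _*ℚ_)

ten-ninths : ∀ k → ℕtoℚ (10 * k) ≡ (+ 10 / 9) *ℚ ℕtoℚ (9 * k)
ten-ninths k = begin
  ℕtoℚ (10 * k)                        ≡⟨ ℕtoℚ-* 10 k ⟩
  ℕtoℚ 10 *ℚ ℕtoℚ k                    ≡⟨⟩
  ((+ 10 / 9) *ℚ ℕtoℚ 9) *ℚ ℕtoℚ k     ≡⟨ ℚP.*-assoc (+ 10 / 9) (ℕtoℚ 9) (ℕtoℚ k) ⟩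
  (+ 10 / 9) *ℚ (ℕtoℚ 9 *ℚ ℕtoℚ k)     ≡⟨ cong ((+ 10 / 9) *ℚ_) (ℕtoℚ-* 9 k) ⟨
  (+ 10 / 9) *ℚ ℕtoℚ (9 * k)           ∎
  where open ≡-Reasoning

corollary5 : ∀ (k : ℕ) → 1 ≤ k →
    ∃ λ (G : Graph) → Connected G × Chordal G ×
      ∃ λ (m : ℕ) → ∃ λ (q : ℚ) → ∃ λ (g : ℕ) →
        MultipackingNumber G m × FracMultipackingNumber G q × BroadcastDomNumber G g ×
        m ≡ 9 * k × q ≡ (+ 10 / 9) *ℚ ℕtoℚ m × ℕtoℚ g ≡ (+ 10 / 9) *ℚ ℕtoℚ m
corollary5 (suc j) _ =
  chain j , Distance.connected (distance j) , peo⇒chordal (chain-peo unitPEO entry-last j) ,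
  9 * suc j , ℕtoℚ (10 * suc j) , 10 * suc j ,
  ((packingChain j , packingChain-multipacking j , packingChain-size j) , mp-upper) ,
  proj₁ optimal , proj₂ optimal , refl , ten-ninths (suc j) , ten-ninths (suc j)
  where
  mp-upper : ∀ M → IsMultipacking (chain j) M → card (chain j) M ≤ 9 * suc j
  mp-upper M M-mp =
    subst (card (chain j) M ≤_) (ℕP.*-comm (suc j) 9) (multipacking-bound unit-multipacking-bound j M M-mp)
  optimal : FracMultipackingNumber (chain j) (ℕtoℚ (10 * suc j)) × BroadcastDomNumber (chain j) (10 * suc j)
  optimal = duality-certificate (chain j) (halfChain-fractional j) (broadcastChain-broadcast j) (broadcastChain-dominating j)
                                (halfChain-weight j) (broadcastChain-cost j)
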